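{- Let $q$ be a prime power, $1\le k\le n-1$, and let $C\subseteq(\mathbb{F}_q)^n$ be a systematic $(n,k,q)$ code. Let $G$ be the reduced Gröbner basis of the vanishing ideal $\mathcal{I}(C)\subseteq\mathbb{F}_q[x_1,\dots,x_k,z_1,\dots,z_{n-k}]$ with respect to the lexicographic order with $x_1<\dots<x_k<z_1<\dots<z_{n-k}$. Then $$G=E_q[X]\cup\{z_1-f_1,\dots,z_{n-k}-f_{n-k}\}$$ for some polynomials $f_j\in\mathbb{F}_q[x_1,\dots,x_k]$, $1\le j\le n-k$.
   Context: An $(n,k,q)$ code is the image $C=\mathrm{Im}(\phi)$ of an injective map $\phi:(\mathbb{F}_q)^k\to(\mathbb{F}_q)^n$; it is systematic if the first $k$ coordinates of $\phi(v)$ equal $v$ for every $v\in(\mathbb{F}_q)^k$. Points $(a_1,\dots,a_n)$ of $C$ correspond to $(x_1,\dots,x_k,z_1,\dots,z_{n-k})=(a_1,\dots,a_n)$, and $\mathcal{I}(C)$ is the ideal of all polynomials vanishing on $C$. $E_q[X]=\{x_1^q-x_1,\dots,x_k^q-x_k\}$. -}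

module Defs where

open import Level using (0ℓ)
open import Data.Nat as ℕ using (ℕ; zero; suc; _≤_; _<_)
open import Data.Nat.Primality using (Prime)
open import Data.Fin as Fin using (Fin; toℕ; _↑ˡ_; _↑ʳ_)
open import Data.Fin.Properties using () 
open import Data.Vec as Vec using (Vec; lookup; replicate; take; _[_]≔_)
open import Data.Vec.Properties using (≡-dec)
open import Data.Vec.Relation.Binary.Pointwise.Inductive using (Pointwise)
open import Data.List as List using (List; []; _∷_; _++_; allFin; length)
open import Data.List.Relation.Unary.All using (All)
open import Data.List.Relation.Unary.Any using (Any)
open import Data.Product using (Σ; ∃; ∃-syntax; _×_; _,_)
open import Data.Sum using (_⊎_)
open import Function.Bundles using (_↔_; _⇔_)
open import Relation.Binary.Definitions using (DecidableEquality)
open import Relation.Binary.PropositionalEquality using (_≡_; _≢_)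
open import Relation.Nullary using (¬_; yes; no)
open import Algebra.Structures using (IsCommutativeRing)

record Field : Set₁ where
  infixl 6 _+_
  infixl 7 _*_
  field
    F          : Set
    _≟_        : DecidableEquality F
    _+_ _*_    : F → F → F
    -_         : F → F
    0# 1#      : F
    isCommutativeRing : IsCommutativeRing _≡_ _+_ _*_ -_ 0# 1#
    0≢1        : 0# ≢ 1#
    inverse    : ∀ x → x ≢ 0# → Σ F λ y → x * y ≡ 1#

IsPrimePower : ℕ → Set
IsPrimePower q = Σ ℕ λ p → Σ ℕ λ m → Prime p × 1 ≤ m × q ≡ p ℕ.^ m

HasCardinality : Field → ℕ → Set
HasCardinality K q = Fin q ↔ Field.F K

IsSystematicCode : (K : Field) (k r : ℕ) → (Vec (Field.F K) k → Vec (Field.F K) (k ℕ.+ r)) → Set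
IsSystematicCode K k r φ =
  (∀ v w → φ v ≡ φ w → v ≡ w) × (∀ v → take k (φ v) ≡ v)

module Poly (K : Field) where
  open Field K

  Monomial : ℕ → Set
  Monomial N = Vec ℕ N

  -- Polynomials as formal finite sums of terms c·x^m; semantics via coeff.
  Polynomial : ℕ → Set
  Polynomial N = List (F × Monomial N)

  coeff : ∀ {N} → Polynomial N → Monomial N → F
  coeff [] m = 0#
  coeff ((c , m′) ∷ p) m with ≡-dec ℕ._≟_ m′ m
  ... | yes _ = c + coeff p m
  ... | no  _ = coeff p m

  _≈_ : ∀ {N} → Polynomial N → Polynomial N → Set
  p ≈ p′ = ∀ m → coeff p m ≡ coeff p′ m

  NonZeroPoly : ∀ {N} → Polynomial N → Set
  NonZeroPoly p = ∃[ m ] coeff p m ≢ 0#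

  _^F_ : F → ℕ → F
  a ^F zero  = 1#
  a ^F suc e = a * (a ^F e)

  evalMono : ∀ {N} → Monomial N → Vec F N → F
  evalMono Vec.[] Vec.[] = 1#
  evalMono (e Vec.∷ m) (a Vec.∷ as) = (a ^F e) * evalMono m as

  eval : ∀ {N} → Polynomial N → Vec F N → F
  eval [] a = 0#
  eval ((c , m) ∷ p) a = c * evalMono m a + eval p a

  negP : ∀ {N} → Polynomial N → Polynomial N
  negP = List.map (λ { (c , m) → (- c , m) })

  _-P_ : ∀ {N} → Polynomial N → Polynomial N → Polynomial N
  p -P p′ = p ++ negP p′

  varPow : ∀ {N} → Fin N → ℕ → Monomial N
  varPow i e = replicate _ 0 [ i ]≔ e

  _∣M_ : ∀ {N} → Monomial N → Monomial N → Set
  m ∣M m′ = Pointwise _≤_ m m′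

  -- Lexicographic order, variable with larger index is more significant
  -- (variables ordered v_0 < v_1 < ... < v_{N-1}).
  _<lex_ : ∀ {N} → Monomial N → Monomial N → Set
  m <lex m′ = ∃[ i ] (lookup m i < lookup m′ i
                      × (∀ j → toℕ i < toℕ j → lookup m j ≡ lookup m′ j))

  _≤lex_ : ∀ {N} → Monomial N → Monomial N → Set
  m ≤lex m′ = m ≡ m′ ⊎ m <lex m′

  IsLeadingMonomial : ∀ {N} → Polynomial N → Monomial N → Set
  IsLeadingMonomial p m = coeff p m ≢ 0# × (∀ m′ → coeff p m′ ≢ 0# → m′ ≤lex m)

  -- G (a finite list) is a Gröbner basis of the ideal I (given as a
  -- predicate) w.r.t. lex: G ⊆ I and ⟨LT(G)⟩ = ⟨LT(I)⟩, i.e. the leading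
  -- monomial of each nonzero f ∈ I is divisible by that of some g ∈ G.
  IsGroebnerBasis : ∀ {N} → (Polynomial N → Set) → List (Polynomial N) → Set
  IsGroebnerBasis I G =
    All I G ×
    (∀ f → I f → NonZeroPoly f →
      Any (λ g → ∃[ mg ] ∃[ mf ] (IsLeadingMonomial g mg × IsLeadingMonomial f mf × mg ∣M mf)) G)

  IsReducedGroebnerBasis : ∀ {N} → (Polynomial N → Set) → List (Polynomial N) → Set
  IsReducedGroebnerBasis I G =
    IsGroebnerBasis I G ×
    (∀ i → ∃[ m ] (IsLeadingMonomial (List.lookup G i) m × coeff (List.lookup G i) m ≡ 1#)) ×
    (∀ i j → i ≢ j → ∀ m → coeff (List.lookup G i) m ≢ 0# →
      ∀ lm → IsLeadingMonomial (List.lookup G j) lm → ¬ (lm ∣M m))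

  VanishingIdeal : ∀ {k N} → (Vec F k → Vec F N) → Polynomial N → Set
  VanishingIdeal φ p = ∀ v → eval p (φ v) ≡ 0#

  _≈Set_ : ∀ {N} → List (Polynomial N) → List (Polynomial N) → Set
  G ≈Set H = ∀ g → (Any (g ≈_) G → Any (g ≈_) H) × (Any (g ≈_) H → Any (g ≈_) G)

  module Vars (k r : ℕ) where
    xVar : Fin k → Fin (k ℕ.+ r)
    xVar i = i ↑ˡ r

    zVar : Fin r → Fin (k ℕ.+ r)
    zVar j = k ↑ʳ j

    InX : Polynomial (k ℕ.+ r) → Set
    InX f = ∀ m → coeff f m ≢ 0# → ∀ j → lookup m (zVar j) ≡ 0

    Eq : ℕ → List (Polynomial (k ℕ.+ r))
    Eq q = List.map (λ i → ((1# , varPow (xVar i) q) ∷ []) -P ((1# , varPow (xVar i) 1) ∷ []))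
                    (allFin k)

    Zs : (Fin r → Polynomial (k ℕ.+ r)) → List (Polynomial (k ℕ.+ r))
    Zs f = List.map (λ j → ((1# , varPow (zVar j) 1) ∷ []) -P f j) (allFin r)

module Submission where

-- For a systematic code these give
-- (SystematicCode) two key facts: (1) no element of I(C) has a standard
-- leading monomial (z-free with x-exponents < q), because on codewords it
-- becomes a polynomial in the message whose exponents reduce below q; and
-- (2) x_i^q - x_i and z_j - f_j(x), with f_j obtained by Lagrange
-- interpolation, lie in I(C) with leading monomials x_i^q and z_j.  For a
-- reduced basis (ReducedBasisOfCode) it follows that its leading monomials are
-- exactly the x_i^q and z_j and all other monomials are standard; comparing
-- each element with (2), their difference has only standard monomials and so
-- vanishes by (1).

open import Defs
open import Level using (0ℓ)
open import Data.Nat as ℕ using (ℕ; zero; suc; _≤_; _<_; z≤n; s≤s; _∸_)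
import Data.Nat.Properties as ℕP
open import Data.Fin as Fin using (Fin; zero; suc; toℕ; fromℕ<)
import Data.Fin.Properties as FinP
open import Data.Fin.Permutation using (Permutation; permutation)
open import Data.Vec as Vec using (Vec; []; _∷_; lookup; tabulate; take; drop; replicate; zipWith)
import Data.Vec.Properties as VecP
open import Data.Vec.Relation.Binary.Pointwise.Inductive as PW using ([]; _∷_)
open import Data.List as List using (List; []; _∷_; _++_; length)
open import Data.List.Relation.Unary.All as All using (All)
import Data.List.Relation.Unary.All.Properties as AllP
open import Data.List.Relation.Unary.Any as Any using (Any)
import Data.List.Relation.Unary.Any.Properties as AnyP
open import Data.List.Membership.Propositional.Properties using (∈-allFin; ∈-lookup)
open import Data.Product using (Σ; ∃; ∃-syntax; _×_; _,_; proj₁; proj₂)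
open import Data.Sum using (_⊎_; inj₁; inj₂)
open import Data.Empty using (⊥; ⊥-elim)
open import Relation.Nullary using (¬_; yes; no; Dec)
open import Relation.Binary.PropositionalEquality
open import Relation.Binary.Definitions using (tri<; tri≈; tri>)
open import Function.Bundles using (_↔_; Inverse)
open import Algebra.Bundles using (CommutativeRing)
open import Algebra.Structures using (IsCommutativeRing)
import Algebra.Properties.CommutativeSemigroup as CommSemigroupProperties
import Algebra.Properties.AbelianGroup as AbelianGroupProperties
import Algebra.Properties.Ring as RingProperties
import Algebra.Properties.Semiring.Sum as SemiringSum
import Algebra.Properties.CommutativeMonoid.Sum as CommMonoidSum

module FieldLemmas (K : Field) where
  open Field K public
  open IsCommutativeRing isCommutativeRing public
    using (+-comm; +-assoc; +-identityˡ; +-identityʳ; *-comm; *-assoc; *-identityˡ; *-identityʳ;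
           distribˡ; distribʳ; zeroˡ; zeroʳ; -‿inverseˡ; -‿inverseʳ)

  commutativeRing : CommutativeRing 0ℓ 0ℓ
  commutativeRing = record { isCommutativeRing = isCommutativeRing }

  open CommutativeRing commutativeRing public
    using (_-_; semiring; ring; +-abelianGroup; *-commutativeMonoid;
           +-commutativeSemigroup; *-commutativeSemigroup)
  open RingProperties ring public using (-‿distribˡ-*; x[y-z]≈xy-xz)
  open AbelianGroupProperties +-abelianGroup public
    using (⁻¹-involutive)
    renaming (ε⁻¹≈ε to -0≡0; x∙y⁻¹≈ε⇒x≈y to x-y≡0⇒x≡y; ⁻¹-∙-comm to -x+-y≡-[x+y])
  open CommSemigroupProperties +-commutativeSemigroup public
    renaming (interchange to +-interchange; x∙yz≈y∙xz to +-left-swap) using ()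
  open CommSemigroupProperties *-commutativeSemigroup public
    renaming (interchange to *-interchange; x∙yz≈y∙xz to *-left-swap) using ()
  open SemiringSum semiring public using (sum; sum-cong-≗; sum-replicate-zero; ∑-distrib-+; *-distribˡ-sum)
  open Poly K using (_^F_)
  open ≡-Reasoning

  module Product = CommMonoidSum *-commutativeMonoid

  prod : ∀ {n} → (Fin n → F) → F
  prod = Product.sum

  x-x≡0 : ∀ x → x - x ≡ 0#
  x-x≡0 = -‿inverseʳ

  x-0≡x : ∀ x → x - 0# ≡ x
  x-0≡x x = trans (cong (x +_) -0≡0) (+-identityʳ x)

  x-[x-y]≡y : ∀ x y → x - (x - y) ≡ y
  x-[x-y]≡y x y = begin
    x + - (x + - y)   ≡⟨ cong (x +_) (sym (-x+-y≡-[x+y] x (- y))) ⟩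
    x + (- x + - - y) ≡⟨ sym (+-assoc x (- x) _) ⟩
    (x - x) + - - y   ≡⟨ cong₂ _+_ (x-x≡0 x) (⁻¹-involutive y) ⟩
    0# + y            ≡⟨ +-identityˡ y ⟩
    y                 ∎

  [x-y]+y≡x : ∀ x y → (x - y) + y ≡ x
  [x-y]+y≡x x y = trans (+-assoc x (- y) y) (trans (cong (x +_) (-‿inverseˡ y)) (+-identityʳ x))

  sum-single : ∀ {n} (f : Fin n → F) i₀ → (∀ i → i ≢ i₀ → f i ≡ 0#) → sum f ≡ f i₀
  sum-single {suc n} f zero h = trans (cong (f zero +_) rest≡0) (+-identityʳ _)
    where
    rest≡0 : sum (λ i → f (suc i)) ≡ 0#
    rest≡0 = trans (sum-cong-≗ (λ i → h (suc i) λ ())) (sum-replicate-zero n)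
  sum-single {suc n} f (suc i₀) h = trans (cong₂ _+_ (h zero λ ()) (sum-single (λ i → f (suc i)) i₀
    (λ i i≢i₀ → h (suc i) (λ e → i≢i₀ (FinP.suc-injective e))))) (+-identityˡ _)

  1≢0 : 1# ≢ 0#
  1≢0 e = 0≢1 (sym e)

  no-zero-divisors : ∀ x y → x * y ≡ 0# → x ≢ 0# → y ≡ 0#
  no-zero-divisors x y xy≡0 x≢0 = begin
      y            ≡⟨ sym (*-identityˡ y) ⟩
      1# * y       ≡⟨ cong (_* y) (sym (trans (*-comm x′ x) xx′≡1)) ⟩
      (x′ * x) * y ≡⟨ *-assoc x′ x y ⟩
      x′ * (x * y) ≡⟨ cong (x′ *_) xy≡0 ⟩
      x′ * 0#      ≡⟨ zeroʳ x′ ⟩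
      0#           ∎
    where
    x′ = proj₁ (inverse x x≢0)
    xx′≡1 = proj₂ (inverse x x≢0)

  *-≡0 : ∀ {x y} → x ≡ 0# ⊎ y ≡ 0# → x * y ≡ 0#
  *-≡0 {y = y} (inj₁ refl) = zeroˡ y
  *-≡0 {x} (inj₂ refl) = zeroʳ x

  *-≢0 : ∀ x y → x ≢ 0# → y ≢ 0# → x * y ≢ 0#
  *-≢0 x y x≢0 y≢0 xy≡0 = y≢0 (no-zero-divisors x y xy≡0 x≢0)

  prod-≡0 : ∀ {n} (f : Fin n → F) i → f i ≡ 0# → prod f ≡ 0#
  prod-≡0 f zero fᵢ≡0 = trans (cong (_* prod (λ j → f (suc j))) fᵢ≡0) (zeroˡ _)
  prod-≡0 f (suc i) fᵢ≡0 = trans (cong (f zero *_) (prod-≡0 (λ j → f (suc j)) i fᵢ≡0)) (zeroʳ _)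

  *-cancelˡ : ∀ x y z → x ≢ 0# → x * y ≡ x * z → y ≡ z
  *-cancelˡ x y z x≢0 xy≡xz = x-y≡0⇒x≡y y z (no-zero-divisors x (y - z) x[y-z]≡0 x≢0)
    where
    x[y-z]≡0 : x * (y - z) ≡ 0#
    x[y-z]≡0 = trans (x[y-z]≈xy-xz x y z) (trans (cong (_- x * z) xy≡xz) (x-x≡0 (x * z)))

  ^F-+ : ∀ x e e′ → x ^F (e ℕ.+ e′) ≡ (x ^F e) * (x ^F e′)
  ^F-+ x zero e′ = sym (*-identityˡ _)
  ^F-+ x (suc e) e′ = trans (cong (x *_) (^F-+ x e e′)) (sym (*-assoc _ _ _))

  0^F-pos : ∀ e → 0 < e → 0# ^F e ≡ 0#
  0^F-pos (suc e) _ = zeroˡ _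

module PolynomialCalculus (K : Field) where
  open FieldLemmas K
  open Poly K
  open ≡-Reasoning

  _≟M_ : ∀ {N} → (m m′ : Monomial N) → Dec (m ≡ m′)
  _≟M_ = VecP.≡-dec ℕ._≟_

  -- The linear functional  p ↦ Σ c · w m  over the terms (c , m) of p.
  -- Evaluation at a is the weight  m ↦ m(a); other weights regroup terms.
  weigh : ∀ {N} → Polynomial N → (Monomial N → F) → F
  weigh [] w = 0#
  weigh ((c , m) ∷ p) w = c * w m + weigh p w

  eval≡weigh : ∀ {N} (p : Polynomial N) a → eval p a ≡ weigh p (λ m → evalMono m a)
  eval≡weigh [] a = refl
  eval≡weigh ((c , m) ∷ p) a = cong (c * evalMono m a +_) (eval≡weigh p a)

  weigh-++ : ∀ {N} (p p′ : Polynomial N) w → weigh (p ++ p′) w ≡ weigh p w + weigh p′ w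
  weigh-++ [] p′ w = sym (+-identityˡ _)
  weigh-++ ((c , m) ∷ p) p′ w = trans (cong (c * w m +_) (weigh-++ p p′ w)) (sym (+-assoc _ _ _))

  weigh-negP : ∀ {N} (p : Polynomial N) w → weigh (negP p) w ≡ - weigh p w
  weigh-negP [] w = sym -0≡0
  weigh-negP ((c , m) ∷ p) w =
    trans (cong₂ _+_ (sym (-‿distribˡ-* c (w m))) (weigh-negP p w)) (-x+-y≡-[x+y] _ _)

  weigh--P : ∀ {N} (p p′ : Polynomial N) w → weigh (p -P p′) w ≡ weigh p w - weigh p′ w
  weigh--P p p′ w = trans (weigh-++ p (negP p′) w) (cong (weigh p w +_) (weigh-negP p′ w))

  weigh-*ʳ : ∀ {N} (p : Polynomial N) w c → weigh p (λ m → w m * c) ≡ weigh p w * c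
  weigh-*ʳ [] w c = sym (zeroˡ c)
  weigh-*ʳ ((c′ , m) ∷ p) w c =
    trans (cong₂ _+_ (sym (*-assoc c′ (w m) c)) (weigh-*ʳ p w c)) (sym (distribʳ c _ _))

  weigh-pointwise-- : ∀ {N} (p : Polynomial N) u v → weigh p (λ m → u m - v m) ≡ weigh p u - weigh p v
  weigh-pointwise-- [] u v = sym (x-0≡x 0#)
  weigh-pointwise-- ((c , m) ∷ p) u v = begin
    c * (u m - v m) + weigh p (λ m → u m - v m)   ≡⟨ cong₂ _+_ (x[y-z]≈xy-xz c (u m) (v m)) (weigh-pointwise-- p u v) ⟩
    (c * u m - c * v m) + (weigh p u - weigh p v) ≡⟨ +-interchange _ _ _ _ ⟩
    (c * u m + weigh p u) + (- (c * v m) + - weigh p v) ≡⟨ cong ((c * u m + weigh p u) +_) (-x+-y≡-[x+y] _ _) ⟩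
    (c * u m + weigh p u) - (c * v m + weigh p v) ∎

  eval-++ : ∀ {N} (p p′ : Polynomial N) a → eval (p ++ p′) a ≡ eval p a + eval p′ a
  eval-++ p p′ a = trans (eval≡weigh (p ++ p′) a)
    (trans (weigh-++ p p′ _) (sym (cong₂ _+_ (eval≡weigh p a) (eval≡weigh p′ a))))

  eval--P : ∀ {N} (p p′ : Polynomial N) a → eval (p -P p′) a ≡ eval p a - eval p′ a
  eval--P p p′ a = trans (eval≡weigh (p -P p′) a)
    (trans (weigh--P p p′ _) (sym (cong₂ _-_ (eval≡weigh p a) (eval≡weigh p′ a))))

  coeff-++ : ∀ {N} (p p′ : Polynomial N) m → coeff (p ++ p′) m ≡ coeff p m + coeff p′ m
  coeff-++ [] p′ m = sym (+-identityˡ _)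
  coeff-++ ((c , m′) ∷ p) p′ m with m′ ≟M m
  ... | yes _ = trans (cong (c +_) (coeff-++ p p′ m)) (sym (+-assoc _ _ _))
  ... | no _ = coeff-++ p p′ m

  coeff-negP : ∀ {N} (p : Polynomial N) m → coeff (negP p) m ≡ - coeff p m
  coeff-negP [] m = sym -0≡0
  coeff-negP ((c , m′) ∷ p) m with m′ ≟M m
  ... | yes _ = trans (cong (- c +_) (coeff-negP p m)) (-x+-y≡-[x+y] _ _)
  ... | no _ = coeff-negP p m

  coeff--P : ∀ {N} (p p′ : Polynomial N) m → coeff (p -P p′) m ≡ coeff p m - coeff p′ m
  coeff--P p p′ m = trans (coeff-++ p (negP p′) m) (cong (coeff p m +_) (coeff-negP p′ m))

  drop-monomial : ∀ {N} → Monomial N → Polynomial N → Polynomial N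
  drop-monomial m₀ [] = []
  drop-monomial m₀ ((c , m) ∷ p) with m ≟M m₀
  ... | yes _ = drop-monomial m₀ p
  ... | no _ = (c , m) ∷ drop-monomial m₀ p

  length-drop-monomial : ∀ {N} (m₀ : Monomial N) p → length (drop-monomial m₀ p) ≤ length p
  length-drop-monomial m₀ [] = z≤n
  length-drop-monomial m₀ ((c , m) ∷ p) with m ≟M m₀
  ... | yes _ = ℕP.m≤n⇒m≤1+n (length-drop-monomial m₀ p)
  ... | no _ = s≤s (length-drop-monomial m₀ p)

  length-drop-head : ∀ {N} c (m : Monomial N) p → length (drop-monomial m ((c , m) ∷ p)) ≤ length p
  length-drop-head c m p with m ≟M m
  ... | yes _ = length-drop-monomial m p
  ... | no m≢m = ⊥-elim (m≢m refl)

  coeff-drop-same : ∀ {N} (m₀ : Monomial N) p → coeff (drop-monomial m₀ p) m₀ ≡ 0#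
  coeff-drop-same m₀ [] = refl
  coeff-drop-same m₀ ((c , m) ∷ p) with m ≟M m₀
  ... | yes _ = coeff-drop-same m₀ p
  ... | no m≢m₀ with m ≟M m₀
  ...   | yes m≡m₀ = ⊥-elim (m≢m₀ m≡m₀)
  ...   | no _ = coeff-drop-same m₀ p

  coeff-drop-other : ∀ {N} (m₀ m₁ : Monomial N) p → m₁ ≢ m₀ → coeff (drop-monomial m₀ p) m₁ ≡ coeff p m₁
  coeff-drop-other m₀ m₁ [] _ = refl
  coeff-drop-other m₀ m₁ ((c , m) ∷ p) m₁≢m₀ with m ≟M m₀ | m ≟M m₁
  ... | yes refl | yes refl = ⊥-elim (m₁≢m₀ refl)
  ... | yes _ | no _ = coeff-drop-other m₀ m₁ p m₁≢m₀
  ... | no _ | yes m≡m₁ with m ≟M m₁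
  ...   | yes _ = cong (c +_) (coeff-drop-other m₀ m₁ p m₁≢m₀)
  ...   | no m≢m₁ = ⊥-elim (m≢m₁ m≡m₁)
  coeff-drop-other m₀ m₁ ((c , m) ∷ p) m₁≢m₀ | no _ | no m≢m₁ with m ≟M m₁
  ...   | yes m≡m₁ = ⊥-elim (m≢m₁ m≡m₁)
  ...   | no _ = coeff-drop-other m₀ m₁ p m₁≢m₀

  coeff-drop : ∀ {N} (m₀ m₁ : Monomial N) p → coeff (drop-monomial m₀ p) m₁ ≡ 0# ⊎ coeff (drop-monomial m₀ p) m₁ ≡ coeff p m₁
  coeff-drop m₀ m₁ p with m₁ ≟M m₀
  ... | yes refl = inj₁ (coeff-drop-same m₀ p)
  ... | no m₁≢m₀ = inj₂ (coeff-drop-other m₀ m₁ p m₁≢m₀)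

  weigh-drop : ∀ {N} (m₀ : Monomial N) p w → weigh p w ≡ coeff p m₀ * w m₀ + weigh (drop-monomial m₀ p) w
  weigh-drop m₀ [] w = sym (trans (cong (_+ 0#) (zeroˡ (w m₀))) (+-identityˡ 0#))
  weigh-drop m₀ ((c , m) ∷ p) w with m ≟M m₀
  ... | yes refl = begin
      c * w m + weigh p w                                  ≡⟨ cong (c * w m +_) (weigh-drop m p w) ⟩
      c * w m + (coeff p m * w m + weigh (drop-monomial m p) w) ≡⟨ sym (+-assoc _ _ _) ⟩
      (c * w m + coeff p m * w m) + weigh (drop-monomial m p) w ≡⟨ cong (_+ weigh (drop-monomial m p) w) (sym (distribʳ (w m) c (coeff p m))) ⟩
      (c + coeff p m) * w m + weigh (drop-monomial m p) w  ∎
  ... | no _ = begin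
      c * w m + weigh p w                                        ≡⟨ cong (c * w m +_) (weigh-drop m₀ p w) ⟩
      c * w m + (coeff p m₀ * w m₀ + weigh (drop-monomial m₀ p) w) ≡⟨ sym (+-assoc _ _ _) ⟩
      (c * w m + coeff p m₀ * w m₀) + weigh (drop-monomial m₀ p) w ≡⟨ cong (_+ weigh (drop-monomial m₀ p) w) (+-comm _ _) ⟩
      (coeff p m₀ * w m₀ + c * w m) + weigh (drop-monomial m₀ p) w ≡⟨ +-assoc _ _ _ ⟩
      coeff p m₀ * w m₀ + (c * w m + weigh (drop-monomial m₀ p) w) ∎

  -- The induction (on the
  -- length, as fuel) removes all terms of the head monomial at once.
  weigh-vanishes : ∀ {N} (p : Polynomial N) w → (∀ m → coeff p m ≡ 0# ⊎ w m ≡ 0#) → weigh p w ≡ 0#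
  weigh-vanishes {N} p w = go (length p) p ℕP.≤-refl
    where
    go : ∀ n (p : Polynomial N) → length p ≤ n → (∀ m → coeff p m ≡ 0# ⊎ w m ≡ 0#) → weigh p w ≡ 0#
    go _ [] _ _ = refl
    go (suc n) ((c , m) ∷ p) (s≤s len) h = begin
        weigh P w                               ≡⟨ weigh-drop m P w ⟩
        coeff P m * w m + weigh (drop-monomial m P) w ≡⟨ cong₂ _+_ (*-≡0 (h m)) (go n (drop-monomial m P) (ℕP.≤-trans (length-drop-head c m p) len) h′) ⟩
        0# + 0#                                 ≡⟨ +-identityʳ 0# ⟩
        0#                                      ∎
      where
      P = (c , m) ∷ p
      h′ : ∀ m′ → coeff (drop-monomial m P) m′ ≡ 0# ⊎ w m′ ≡ 0#
      h′ m′ with coeff-drop m m′ P | h m′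
      ... | inj₁ dropped | _ = inj₁ dropped
      ... | inj₂ kept | inj₁ zero-coeff = inj₁ (trans kept zero-coeff)
      ... | inj₂ _ | inj₂ zero-weight = inj₂ zero-weight

  weigh-single : ∀ {N} (p : Polynomial N) w M → (∀ m → m ≢ M → coeff p m ≡ 0# ⊎ w m ≡ 0#) →
    weigh p w ≡ coeff p M * w M
  weigh-single p w M h = begin
      weigh p w                                     ≡⟨ weigh-drop M p w ⟩
      coeff p M * w M + weigh (drop-monomial M p) w ≡⟨ cong (coeff p M * w M +_) (weigh-vanishes (drop-monomial M p) w h′) ⟩
      coeff p M * w M + 0#                          ≡⟨ +-identityʳ _ ⟩
      coeff p M * w M                               ∎
    where
    h′ : ∀ m → coeff (drop-monomial M p) m ≡ 0# ⊎ w m ≡ 0#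
    h′ m with m ≟M M
    ... | yes refl = inj₁ (coeff-drop-same M p)
    ... | no m≢M = subst (λ x → x ≡ 0# ⊎ w m ≡ 0#) (sym (coeff-drop-other M m p m≢M)) (h m m≢M)

  weigh-cong : ∀ {N} (p : Polynomial N) u v → (∀ m → coeff p m ≢ 0# → u m ≡ v m) → weigh p u ≡ weigh p v
  weigh-cong p u v h = x-y≡0⇒x≡y _ _ (trans (sym (weigh-pointwise-- p u v)) (weigh-vanishes p _ h′))
    where
    h′ : ∀ m → coeff p m ≡ 0# ⊎ u m - v m ≡ 0#
    h′ m with coeff p m ≟ 0#
    ... | yes c≡0 = inj₁ c≡0
    ... | no c≢0 = inj₂ (trans (cong (_- v m) (h m c≢0)) (x-x≡0 (v m)))

  term : ∀ {N} → F → Monomial N → Polynomial N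
  term c m = (c , m) ∷ []

  coeff-term-same : ∀ {N} c (m : Monomial N) → coeff (term c m) m ≡ c
  coeff-term-same c m with m ≟M m
  ... | yes _ = +-identityʳ c
  ... | no m≢m = ⊥-elim (m≢m refl)

  coeff-term-other : ∀ {N} c (m m′ : Monomial N) → m ≢ m′ → coeff (term c m) m′ ≡ 0#
  coeff-term-other c m m′ m≢m′ with m ≟M m′
  ... | yes m≡m′ = ⊥-elim (m≢m′ m≡m′)
  ... | no _ = refl

  eval-term : ∀ {N} c (m : Monomial N) a → eval (term c m) a ≡ c * evalMono m a
  eval-term c m a = +-identityʳ _

  evalMono-unit : ∀ {N} (a : Vec F N) → evalMono (replicate N 0) a ≡ 1#
  evalMono-unit [] = refl
  evalMono-unit (x ∷ a) = trans (*-identityˡ _) (evalMono-unit a)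

  evalMono-zipWith : ∀ {N} (m m′ : Monomial N) a →
    evalMono (zipWith ℕ._+_ m m′) a ≡ evalMono m a * evalMono m′ a
  evalMono-zipWith [] [] [] = sym (*-identityˡ 1#)
  evalMono-zipWith (e ∷ m) (e′ ∷ m′) (x ∷ a) = begin
    x ^F (e ℕ.+ e′) * evalMono (zipWith ℕ._+_ m m′) a        ≡⟨ cong₂ _*_ (^F-+ x e e′) (evalMono-zipWith m m′ a) ⟩
    ((x ^F e) * (x ^F e′)) * (evalMono m a * evalMono m′ a)  ≡⟨ *-interchange _ _ _ _ ⟩
    ((x ^F e) * evalMono m a) * ((x ^F e′) * evalMono m′ a)  ∎

  evalMono-++ : ∀ {n n′} (m : Monomial n) (m′ : Monomial n′) a a′ →
    evalMono (m Vec.++ m′) (a Vec.++ a′) ≡ evalMono m a * evalMono m′ a′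
  evalMono-++ [] m′ [] a′ = sym (*-identityˡ _)
  evalMono-++ (e ∷ m) m′ (x ∷ a) a′ = trans (cong ((x ^F e) *_) (evalMono-++ m m′ a a′)) (sym (*-assoc _ _ _))

  evalMono-varPow : ∀ {N} (i : Fin N) e a → evalMono (varPow i e) a ≡ lookup a i ^F e
  evalMono-varPow zero e (x ∷ a) = trans (cong ((x ^F e) *_) (evalMono-unit a)) (*-identityʳ _)
  evalMono-varPow (suc i) e (x ∷ a) = trans (*-identityˡ _) (evalMono-varPow i e a)

  lookup-varPow-same : ∀ {N} (i : Fin N) e → lookup (varPow i e) i ≡ e
  lookup-varPow-same i e = VecP.lookup∘update i (replicate _ 0) e

  lookup-varPow-other : ∀ {N} (i t : Fin N) e → t ≢ i → lookup (varPow i e) t ≡ 0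
  lookup-varPow-other i t e t≢i = trans (VecP.lookup∘update′ t≢i (replicate _ 0) e) (VecP.lookup-replicate t 0)

  constP : ∀ {N} → F → Polynomial N
  constP c = term c (replicate _ 0)

  eval-constP : ∀ {N} c (a : Vec F N) → eval (constP c) a ≡ c
  eval-constP {N} c a = trans (eval-term c (replicate N 0) a) (trans (cong (c *_) (evalMono-unit a)) (*-identityʳ c))

  scaleP : ∀ {N} → F → Polynomial N → Polynomial N
  scaleP c = List.map (λ { (c′ , m) → (c * c′ , m) })

  eval-scaleP : ∀ {N} c (p : Polynomial N) a → eval (scaleP c p) a ≡ c * eval p a
  eval-scaleP c [] a = sym (zeroʳ c)
  eval-scaleP c ((c′ , m) ∷ p) a =
    trans (cong₂ _+_ (*-assoc c c′ _) (eval-scaleP c p a)) (sym (distribˡ c _ _))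

  mulTerm : ∀ {N} → F × Monomial N → Polynomial N → Polynomial N
  mulTerm (c , m) = List.map (λ { (c′ , m′) → (c * c′ , zipWith ℕ._+_ m m′) })

  _*P_ : ∀ {N} → Polynomial N → Polynomial N → Polynomial N
  [] *P p′ = []
  (t ∷ p) *P p′ = mulTerm t p′ ++ (p *P p′)

  eval-mulTerm : ∀ {N} c (m : Monomial N) p a → eval (mulTerm (c , m) p) a ≡ (c * evalMono m a) * eval p a
  eval-mulTerm c m [] a = sym (zeroʳ _)
  eval-mulTerm c m ((c′ , m′) ∷ p) a = begin
    (c * c′) * evalMono (zipWith ℕ._+_ m m′) a + eval (mulTerm (c , m) p) a
      ≡⟨ cong₂ _+_ (cong ((c * c′) *_) (evalMono-zipWith m m′ a)) (eval-mulTerm c m p a) ⟩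
    (c * c′) * (evalMono m a * evalMono m′ a) + (c * evalMono m a) * eval p a
      ≡⟨ cong (_+ (c * evalMono m a) * eval p a) (*-interchange c c′ (evalMono m a) (evalMono m′ a)) ⟩
    (c * evalMono m a) * (c′ * evalMono m′ a) + (c * evalMono m a) * eval p a
      ≡⟨ sym (distribˡ _ _ _) ⟩
    (c * evalMono m a) * (c′ * evalMono m′ a + eval p a) ∎

  eval-*P : ∀ {N} (p p′ : Polynomial N) a → eval (p *P p′) a ≡ eval p a * eval p′ a
  eval-*P [] p′ a = sym (zeroˡ _)
  eval-*P ((c , m) ∷ p) p′ a = trans (eval-++ (mulTerm (c , m) p′) (p *P p′) a)
    (trans (cong₂ _+_ (eval-mulTerm c m p′ a) (eval-*P p p′ a)) (sym (distribʳ _ _ _)))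

  _^P_ : ∀ {N} → Polynomial N → ℕ → Polynomial N
  p ^P zero = constP 1#
  p ^P suc n = p *P (p ^P n)

  eval-^P : ∀ {N} (p : Polynomial N) n a → eval (p ^P n) a ≡ eval p a ^F n
  eval-^P p zero a = eval-constP 1# a
  eval-^P p (suc n) a = trans (eval-*P p (p ^P n) a) (cong (eval p a *_) (eval-^P p n a))

  ∑P : ∀ {N n} → (Fin n → Polynomial N) → Polynomial N
  ∑P {n = zero} P = []
  ∑P {n = suc n} P = P zero ++ ∑P (λ i → P (suc i))

  eval-∑P : ∀ {N n} (P : Fin n → Polynomial N) a → eval (∑P P) a ≡ sum (λ i → eval (P i) a)
  eval-∑P {n = zero} P a = refl
  eval-∑P {n = suc n} P a =
    trans (eval-++ (P zero) (∑P (λ i → P (suc i))) a) (cong (eval (P zero) a +_) (eval-∑P (λ i → P (suc i)) a))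

  ∏P : ∀ {N n} → (Fin n → Polynomial N) → Polynomial N
  ∏P {n = zero} P = constP 1#
  ∏P {n = suc n} P = P zero *P ∏P (λ i → P (suc i))

  eval-∏P : ∀ {N n} (P : Fin n → Polynomial N) a → eval (∏P P) a ≡ prod (λ i → eval (P i) a)
  eval-∏P {n = zero} P a = eval-constP 1# a
  eval-∏P {n = suc n} P a =
    trans (eval-*P (P zero) (∏P (λ i → P (suc i))) a) (cong (eval (P zero) a *_) (eval-∏P (λ i → P (suc i)) a))

  support--P : ∀ {N} (p p′ : Polynomial N) m → coeff (p -P p′) m ≢ 0# → coeff p m ≢ 0# ⊎ coeff p′ m ≢ 0#
  support--P p p′ m c≢0 with coeff p m ≟ 0# | coeff p′ m ≟ 0#
  ... | no c₁≢0 | _ = inj₁ c₁≢0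
  ... | yes _ | no c₂≢0 = inj₂ c₂≢0
  ... | yes c₁≡0 | yes c₂≡0 = ⊥-elim (c≢0 (trans (coeff--P p p′ m) (trans (cong₂ _-_ c₁≡0 c₂≡0) (x-x≡0 0#))))

  AllMonomials : ∀ {N} → (Monomial N → Set) → Polynomial N → Set
  AllMonomials P = All (λ t → P (proj₂ t))

  support-AllMonomials : ∀ {N} {P : Monomial N → Set} (p : Polynomial N) →
    AllMonomials P p → ∀ m → coeff p m ≢ 0# → P m
  support-AllMonomials [] All.[] m c≢0 = ⊥-elim (c≢0 refl)
  support-AllMonomials ((c , m′) ∷ p) (Pm′ All.∷ Pp) m c≢0 with m′ ≟M m
  ... | yes refl = Pm′
  ... | no _ = support-AllMonomials p Pp m c≢0

  allMonomials-negP : ∀ {N} {P : Monomial N → Set} {p} → AllMonomials P p → AllMonomials P (negP p)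
  allMonomials-negP All.[] = All.[]
  allMonomials-negP (Pm All.∷ Pp) = Pm All.∷ allMonomials-negP Pp

  allMonomials--P : ∀ {N} {P : Monomial N → Set} {p p′} → AllMonomials P p → AllMonomials P p′ →
    AllMonomials P (p -P p′)
  allMonomials--P Pp Pp′ = AllP.++⁺ Pp (allMonomials-negP Pp′)

  module MonomialSubmonoid {N} (P : Monomial N → Set) (P-unit : P (replicate N 0))
         (P-+ : ∀ {m m′} → P m → P m′ → P (zipWith ℕ._+_ m m′)) where

    closed-constP : ∀ c → AllMonomials P (constP c)
    closed-constP c = P-unit All.∷ All.[]

    closed-scaleP : ∀ {c p} → AllMonomials P p → AllMonomials P (scaleP c p)
    closed-scaleP All.[] = All.[]
    closed-scaleP (Pm All.∷ Pp) = Pm All.∷ closed-scaleP Pp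

    closed-mulTerm : ∀ {c m p} → P m → AllMonomials P p → AllMonomials P (mulTerm (c , m) p)
    closed-mulTerm Pm All.[] = All.[]
    closed-mulTerm Pm (Pm′ All.∷ Pp) = P-+ Pm Pm′ All.∷ closed-mulTerm Pm Pp

    closed-*P : ∀ {p p′} → AllMonomials P p → AllMonomials P p′ → AllMonomials P (p *P p′)
    closed-*P All.[] Pp′ = All.[]
    closed-*P (Pm All.∷ Pp) Pp′ = AllP.++⁺ (closed-mulTerm Pm Pp′) (closed-*P Pp Pp′)

    closed-^P : ∀ {p} n → AllMonomials P p → AllMonomials P (p ^P n)
    closed-^P zero Pp = closed-constP 1#
    closed-^P (suc n) Pp = closed-*P Pp (closed-^P n Pp)

    closed-∑P : ∀ {n} (Q : Fin n → Polynomial N) → (∀ i → AllMonomials P (Q i)) → AllMonomials P (∑P Q)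
    closed-∑P {zero} Q PQ = All.[]
    closed-∑P {suc n} Q PQ = AllP.++⁺ (PQ zero) (closed-∑P (λ i → Q (suc i)) (λ i → PQ (suc i)))

    closed-∏P : ∀ {n} (Q : Fin n → Polynomial N) → (∀ i → AllMonomials P (Q i)) → AllMonomials P (∏P Q)
    closed-∏P {zero} Q PQ = closed-constP 1#
    closed-∏P {suc n} Q PQ = closed-*P (PQ zero) (closed-∏P (λ i → Q (suc i)) (λ i → PQ (suc i)))

vec-ext : ∀ {A : Set} {n} {xs ys : Vec A n} → (∀ i → lookup xs i ≡ lookup ys i) → xs ≡ ys
vec-ext {xs = xs} {ys} h =
  trans (sym (VecP.tabulate∘lookup xs)) (trans (VecP.tabulate-cong h) (VecP.tabulate∘lookup ys))

module LexOrder (K : Field) where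
  open Poly K
  open PolynomialCalculus K using (lookup-varPow-same; lookup-varPow-other)

  ∣M-intro : ∀ {N} {m m′ : Monomial N} → (∀ i → lookup m i ≤ lookup m′ i) → m ∣M m′
  ∣M-intro {m = []} {[]} h = []
  ∣M-intro {m = e ∷ m} {e′ ∷ m′} h = h zero ∷ ∣M-intro (λ i → h (suc i))

  <lex-asym : ∀ {N} {m m′ : Monomial N} → m <lex m′ → m′ <lex m → ⊥
  <lex-asym (i , lt , above-i) (i′ , lt′ , above-i′) with ℕP.<-cmp (toℕ i) (toℕ i′)
  ... | tri< i<i′ _ _ = ℕP.<-irrefl (sym (above-i i′ i<i′)) lt′
  ... | tri> _ _ i′<i = ℕP.<-irrefl (sym (above-i′ i i′<i)) lt
  ... | tri≈ _ i≡i′ _ with FinP.toℕ-injective i≡i′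
  ...   | refl = ℕP.<-asym lt lt′

  ≤lex-antisym : ∀ {N} {m m′ : Monomial N} → m ≤lex m′ → m′ ≤lex m → m ≡ m′
  ≤lex-antisym (inj₁ m≡m′) _ = m≡m′
  ≤lex-antisym (inj₂ _) (inj₁ m′≡m) = sym m′≡m
  ≤lex-antisym {m = m} {m′} (inj₂ m<m′) (inj₂ m′<m) = ⊥-elim (<lex-asym {m = m} {m′} m<m′ m′<m)

  ∣M⇒≤lex : ∀ {N} {m m′ : Monomial N} → m ∣M m′ → m ≤lex m′
  ∣M⇒≤lex [] = inj₁ refl
  ∣M⇒≤lex {m = e ∷ m} {e′ ∷ m′} (e≤e′ ∷ m∣m′) with ∣M⇒≤lex m∣m′
  ... | inj₂ (i , lt , above-i) = inj₂ (suc i , lt , λ { zero () ; (suc j) (s≤s i<j) → above-i j i<j })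
  ... | inj₁ refl with e ℕ.≟ e′
  ...   | yes refl = inj₁ refl
  ...   | no e≢e′ = inj₂ (zero , ℕP.≤∧≢⇒< e≤e′ e≢e′ , λ { zero () ; (suc j) _ → refl })

  ∣M-≥lex⇒≡ : ∀ {N} {m m′ : Monomial N} → m ∣M m′ → m′ ≤lex m → m ≡ m′
  ∣M-≥lex⇒≡ m∣m′ m′≤m = ≤lex-antisym (∣M⇒≤lex m∣m′) m′≤m

  leading-monomial-unique : ∀ {N} {p : Polynomial N} {m m′} →
    IsLeadingMonomial p m → IsLeadingMonomial p m′ → m ≡ m′
  leading-monomial-unique (c≢0 , below) (c′≢0 , below′) = ≤lex-antisym (below′ _ c≢0) (below _ c′≢0)

  varPow-<lex : ∀ {N} (v : Fin N) {e e′} → e < e′ → varPow v e <lex varPow v e′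
  varPow-<lex v {e} {e′} e<e′ =
    v , subst₂ _<_ (sym (lookup-varPow-same v e)) (sym (lookup-varPow-same v e′)) e<e′ , above
    where
    above : ∀ t → toℕ v < toℕ t → lookup (varPow v e) t ≡ lookup (varPow v e′) t
    above t v<t = trans (lookup-varPow-other v t e t≢v) (sym (lookup-varPow-other v t e′ t≢v))
      where
      t≢v : t ≢ v
      t≢v refl = ℕP.<-irrefl refl v<t

module FiniteField (K : Field) (q : ℕ) (card : Fin q ↔ Field.F K) where
  open FieldLemmas K
  open Poly K using (_^F_)
  open Inverse card public using (strictlyInverseˡ; strictlyInverseʳ) renaming (to to element; from to index)
  open ≡-Reasoning

  element-injective : ∀ {i j} → element i ≡ element j → i ≡ j
  element-injective {i} {j} e = trans (sym (strictlyInverseʳ i)) (trans (cong index e) (strictlyInverseʳ j))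

  -- 0# and 1# are distinct elements.
  2≤q : 2 ≤ q
  2≤q = ℕP.≰⇒> λ q≤1 → 0≢1 (begin
      0#                 ≡⟨ sym (strictlyInverseˡ 0#) ⟩
      element (index 0#) ≡⟨ cong element (subsingleton q≤1 (index 0#) (index 1#)) ⟩
      element (index 1#) ≡⟨ strictlyInverseˡ 1# ⟩
      1#                 ∎)
    where
    subsingleton : ∀ {n} → n ≤ 1 → (i j : Fin n) → i ≡ j
    subsingleton (s≤s z≤n) zero zero = refl

  0<q : 0 < q
  0<q = ℕP.<-trans (s≤s z≤n) 2≤q

  -- a itself if nonzero, 1 otherwise: the product of these over K is nonzero.
  unit-part : F → F
  unit-part a with a ≟ 0#
  ... | yes _ = 1#
  ... | no _ = a

  unit-part-≢0 : ∀ a → unit-part a ≢ 0#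
  unit-part-≢0 a with a ≟ 0#
  ... | yes _ = 1≢0
  ... | no a≢0 = a≢0

  prod-≢0 : ∀ {n} (f : Fin n → F) → (∀ i → f i ≢ 0#) → prod f ≢ 0#
  prod-≢0 {zero} f h = 1≢0
  prod-≢0 {suc n} f h = *-≢0 _ _ (h zero) (prod-≢0 (λ i → f (suc i)) (λ i → h (suc i)))

  prod-one-hole : ∀ {n} y (s : Fin n → F) i₀ → s i₀ ≡ 1# → (∀ i → i ≢ i₀ → s i ≡ y) → y * prod s ≡ y ^F n
  prod-one-hole {suc n} y s zero s-hole s-rest = cong (y *_) (begin
    s zero * prod (λ i → s (suc i)) ≡⟨ cong₂ _*_ s-hole (Product.sum-cong-≗ (λ i → s-rest (suc i) λ ())) ⟩
    1# * prod {n} (λ _ → y)        ≡⟨ *-identityˡ _ ⟩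
    prod {n} (λ _ → y)             ≡⟨ prod-const n ⟩
    y ^F n                         ∎)
    where
    prod-const : ∀ n → prod {n} (λ _ → y) ≡ y ^F n
    prod-const zero = refl
    prod-const (suc n) = cong (y *_) (prod-const n)
  prod-one-hole {suc n} y s (suc i₀) s-hole s-rest = cong (y *_) (trans (cong (_* prod (λ i → s (suc i))) (s-rest zero λ ()))
    (prod-one-hole y (λ i → s (suc i)) i₀ s-hole (λ i i≢i₀ → s-rest (suc i) (λ e → i≢i₀ (FinP.suc-injective e)))))

  multiplication-permutation : ∀ z u → z * u ≡ 1# → Permutation q q
  multiplication-permutation z u zu≡1 = permutation (λ i → index (z * element i)) (λ i → index (u * element i))
      (undo z u zu≡1) (undo u z (trans (*-comm u z) zu≡1))
    where
    undo : ∀ z u → z * u ≡ 1# → ∀ i → index (z * element (index (u * element i))) ≡ i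
    undo z u zu≡1 i = begin
      index (z * element (index (u * element i))) ≡⟨ cong (λ t → index (z * t)) (strictlyInverseˡ _) ⟩
      index (z * (u * element i))                 ≡⟨ cong index (sym (*-assoc z u _)) ⟩
      index ((z * u) * element i)                 ≡⟨ cong (λ t → index (t * element i)) zu≡1 ⟩
      index (1# * element i)                      ≡⟨ cong index (*-identityˡ _) ⟩
      index (element i)                           ≡⟨ strictlyInverseʳ i ⟩
      i                                           ∎

  prod-unit-part-scaled : ∀ y → y ≢ 0# →
    prod (λ i → unit-part (element i)) ≡ prod (λ i → unit-part (y * element i))
  prod-unit-part-scaled y y≢0 = begin
      prod (λ i → unit-part (element i))
        ≡⟨ Product.sum-permute (λ i → unit-part (element i)) (multiplication-permutation y y⁻¹ yy⁻¹≡1) ⟩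
      prod (λ i → unit-part (element (index (y * element i))))
        ≡⟨ Product.sum-cong-≗ (λ i → cong unit-part (strictlyInverseˡ (y * element i))) ⟩
      prod (λ i → unit-part (y * element i)) ∎
    where
    y⁻¹ = proj₁ (inverse y y≢0)
    yy⁻¹≡1 = proj₂ (inverse y y≢0)

  -- Fermat for y ≢ 0: unit-part (y a) = s a * unit-part a, where s is 1 at 0
  -- and y elsewhere; so the products of unit parts give prod s = 1, while
  -- y * prod s = y ^ q.
  fermat-≢0 : ∀ y → y ≢ 0# → y ^F q ≡ y
  fermat-≢0 y y≢0 = begin
      y ^F q     ≡⟨ sym (prod-one-hole y s (index 0#) s-at-0 s-elsewhere) ⟩
      y * prod s ≡⟨ cong (y *_) prod-s≡1 ⟩
      y * 1#     ≡⟨ *-identityʳ y ⟩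
      y          ∎
    where
    s : Fin q → F
    s i with element i ≟ 0#
    ... | yes _ = 1#
    ... | no _ = y
    s-at-0 : s (index 0#) ≡ 1#
    s-at-0 with element (index 0#) ≟ 0#
    ... | yes _ = refl
    ... | no ≢0 = ⊥-elim (≢0 (strictlyInverseˡ 0#))
    s-elsewhere : ∀ i → i ≢ index 0# → s i ≡ y
    s-elsewhere i i≢ with element i ≟ 0#
    ... | yes ≡0 = ⊥-elim (i≢ (trans (sym (strictlyInverseʳ i)) (cong index ≡0)))
    ... | no _ = refl
    unit-part-scaled : ∀ i → unit-part (y * element i) ≡ s i * unit-part (element i)
    unit-part-scaled i with element i ≟ 0# | (y * element i) ≟ 0#
    ... | yes _ | yes _ = sym (*-identityˡ 1#)
    ... | yes ≡0 | no y·≢0 = ⊥-elim (y·≢0 (trans (cong (y *_) ≡0) (zeroʳ y)))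
    ... | no ≢0 | yes y·≡0 = ⊥-elim (*-≢0 y _ y≢0 ≢0 y·≡0)
    ... | no _ | no _ = refl
    P = prod (λ i → unit-part (element i))
    P≡prod-s*P : P ≡ prod s * P
    P≡prod-s*P = begin
      P                                        ≡⟨ prod-unit-part-scaled y y≢0 ⟩
      prod (λ i → unit-part (y * element i))   ≡⟨ Product.sum-cong-≗ unit-part-scaled ⟩
      prod (λ i → s i * unit-part (element i)) ≡⟨ Product.∑-distrib-+ s (λ i → unit-part (element i)) ⟩
      prod s * P                               ∎
    prod-s≡1 : prod s ≡ 1#
    prod-s≡1 = sym (*-cancelˡ P 1# (prod s) (prod-≢0 _ (λ i → unit-part-≢0 (element i)))
      (trans (*-identityʳ P) (trans P≡prod-s*P (*-comm (prod s) P))))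

  fermat : ∀ y → y ^F q ≡ y
  fermat y with y ≟ 0#
  ... | no y≢0 = fermat-≢0 y y≢0
  ... | yes refl = 0^F-pos q 0<q

  suc-[q-1] : suc (q ∸ 1) ≡ q
  suc-[q-1] = ℕP.m+[n∸m]≡n {1} {q} 0<q

  0<q-1 : 0 < q ∸ 1
  0<q-1 = ℕP.≤-trans (s≤s z≤n) (ℕP.∸-monoˡ-≤ 1 2≤q)

  pow-q-1 : ∀ x → x ≢ 0# → x ^F (q ∸ 1) ≡ 1#
  pow-q-1 x x≢0 = *-cancelˡ x _ _ x≢0
    (trans (subst (λ e → x ^F e ≡ x) (sym suc-[q-1]) (fermat x)) (sym (*-identityʳ x)))

  reduce : ℕ → ℕ
  reduce zero = zero
  reduce (suc e) with suc (reduce e) ℕ.≟ q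
  ... | yes _ = 1
  ... | no _ = suc (reduce e)

  reduce<q : ∀ e → reduce e < q
  reduce<q zero = 0<q
  reduce<q (suc e) with suc (reduce e) ℕ.≟ q
  ... | yes _ = 2≤q
  ... | no ≢q = ℕP.≤∧≢⇒< (reduce<q e) ≢q

  reduce≤ : ∀ e → reduce e ≤ e
  reduce≤ zero = z≤n
  reduce≤ (suc e) with suc (reduce e) ℕ.≟ q
  ... | yes _ = s≤s z≤n
  ... | no _ = s≤s (reduce≤ e)

  reduce-id : ∀ e → e < q → reduce e ≡ e
  reduce-id zero _ = refl
  reduce-id (suc e) e<q with suc (reduce e) ℕ.≟ q
  ... | yes ≡q = ⊥-elim (ℕP.<-irrefl (trans (cong suc (sym (reduce-id e (ℕP.<-trans (ℕP.n<1+n e) e<q)))) ≡q) e<q)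
  ... | no _ = cong suc (reduce-id e (ℕP.<-trans (ℕP.n<1+n e) e<q))

  ^F-reduce : ∀ x e → x ^F reduce e ≡ x ^F e
  ^F-reduce x zero = refl
  ^F-reduce x (suc e) with suc (reduce e) ℕ.≟ q
  ... | yes ≡q = begin
    x * 1#               ≡⟨ *-identityʳ x ⟩
    x                    ≡⟨ sym (fermat x) ⟩
    x ^F q               ≡⟨ cong (x ^F_) (sym ≡q) ⟩
    x * (x ^F reduce e)  ≡⟨ cong (x *_) (^F-reduce x e) ⟩
    x * (x ^F e)         ∎
  ... | no _ = cong (x *_) (^F-reduce x e)

-- The univariate case is the root
-- bound (q distinct roots, degree < q); the general case is by induction on k.
module ReducedPolynomialsVanish (K : Field) (q : ℕ) (card : Fin q ↔ Field.F K) where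
  open FieldLemmas K
  open Poly K using (_^F_; evalMono)
  open FiniteField K q card using (element; element-injective)
  open ≡-Reasoning

  horner : ∀ {d} → Vec F d → F → F
  horner [] x = 0#
  horner (c ∷ cs) x = c + x * horner cs x

  -- Synthetic division by (x - a): the quotient's coefficient vector.
  divide : ∀ {d} → F → Vec F (suc d) → Vec F d
  divide a (c ∷ []) = []
  divide a (c ∷ c′ ∷ cs) = horner (c′ ∷ cs) a ∷ divide a (c′ ∷ cs)

  horner-divide : ∀ {d} a (cs : Vec F (suc d)) x → horner cs x ≡ (x - a) * horner (divide a cs) x + horner cs a
  horner-divide a (c ∷ []) x = begin
    c + x * 0#                  ≡⟨ cong (c +_) (trans (zeroʳ x) (sym (zeroʳ a))) ⟩
    c + a * 0#                  ≡⟨ sym (+-identityˡ _) ⟩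
    0# + (c + a * 0#)           ≡⟨ cong (_+ (c + a * 0#)) (sym (zeroʳ (x - a))) ⟩
    (x - a) * 0# + (c + a * 0#) ∎
  horner-divide a (c ∷ c′ ∷ cs) x = begin
    c + x * horner (c′ ∷ cs) x           ≡⟨ cong (λ t → c + x * t) (horner-divide a (c′ ∷ cs) x) ⟩
    c + x * ((x - a) * Q + e)            ≡⟨ cong (c +_) shift ⟩
    c + ((x - a) * (e + x * Q) + a * e)  ≡⟨ +-left-swap c _ _ ⟩
    (x - a) * (e + x * Q) + (c + a * e)  ∎
    where
    Q = horner (divide a (c′ ∷ cs)) x
    e = horner (c′ ∷ cs) a
    shift : x * ((x - a) * Q + e) ≡ (x - a) * (e + x * Q) + a * e
    shift = begin
      x * ((x - a) * Q + e)                   ≡⟨ distribˡ x _ e ⟩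
      x * ((x - a) * Q) + x * e               ≡⟨ cong₂ _+_ (*-left-swap x (x - a) Q)
                                                   (trans (cong (_* e) (sym ([x-y]+y≡x x a))) (distribʳ e (x - a) a)) ⟩
      (x - a) * (x * Q) + ((x - a) * e + a * e) ≡⟨ sym (+-assoc _ _ _) ⟩
      ((x - a) * (x * Q) + (x - a) * e) + a * e ≡⟨ cong (_+ a * e) (sym (distribˡ (x - a) _ e)) ⟩
      (x - a) * (x * Q + e) + a * e           ≡⟨ cong (λ t → (x - a) * t + a * e) (+-comm _ e) ⟩
      (x - a) * (e + x * Q) + a * e           ∎

  AllZero : ∀ {d} → Vec F d → Set
  AllZero cs = ∀ i → lookup cs i ≡ 0#

  divide-zero : ∀ {d} a (cs : Vec F (suc d)) → AllZero (divide a cs) → horner cs a ≡ 0# → AllZero cs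
  divide-zero a (c ∷ []) _ root zero = trans (sym (trans (cong (c +_) (zeroʳ a)) (+-identityʳ c))) root
  divide-zero a (c ∷ c′ ∷ cs) quotient-zero root = λ where
      zero → trans (sym (trans (cong (λ t → c + a * t) (quotient-zero zero)) (trans (cong (c +_) (zeroʳ a)) (+-identityʳ c)))) root
      (suc i) → divide-zero a (c′ ∷ cs) (λ i → quotient-zero (suc i)) (quotient-zero zero) i

  distinct-roots : ∀ d (cs : Vec F d) (root : Fin d → F) → (∀ i j → root i ≡ root j → i ≡ j) →
    (∀ i → horner cs (root i) ≡ 0#) → AllZero cs
  distinct-roots zero [] root distinct vanish ()
  distinct-roots (suc d) cs root distinct vanish =
    divide-zero a cs (distinct-roots d (divide a cs) (λ i → root (suc i)) distinct′ quotient-vanishes) (vanish zero)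
    where
    a = root zero
    distinct′ : ∀ i j → root (suc i) ≡ root (suc j) → i ≡ j
    distinct′ i j e = FinP.suc-injective (distinct (suc i) (suc j) e)
    quotient-vanishes : ∀ i → horner (divide a cs) (root (suc i)) ≡ 0#
    quotient-vanishes i = no-zero-divisors (b - a) _ product≡0 b-a≢0
      where
      b = root (suc i)
      product≡0 : (b - a) * horner (divide a cs) b ≡ 0#
      product≡0 = begin
        (b - a) * horner (divide a cs) b                  ≡⟨ sym (+-identityʳ _) ⟩
        (b - a) * horner (divide a cs) b + 0#             ≡⟨ cong ((b - a) * horner (divide a cs) b +_) (sym (vanish zero)) ⟩
        (b - a) * horner (divide a cs) b + horner cs a    ≡⟨ sym (horner-divide a cs b) ⟩
        horner cs b                                       ≡⟨ vanish (suc i) ⟩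
        0#                                                ∎
      b-a≢0 : b - a ≢ 0#
      b-a≢0 b-a≡0 with distinct (suc i) zero (x-y≡0⇒x≡y b a b-a≡0)
      ... | ()

  horner-tabulate : ∀ {d} (c : Fin d → F) x → horner (tabulate c) x ≡ sum (λ e → c e * (x ^F toℕ e))
  horner-tabulate {zero} c x = refl
  horner-tabulate {suc d} c x = cong₂ _+_ (sym (*-identityʳ (c zero))) (begin
    x * horner (tabulate (λ i → c (suc i))) x       ≡⟨ cong (x *_) (horner-tabulate (λ i → c (suc i)) x) ⟩
    x * sum (λ e → c (suc e) * (x ^F toℕ e))        ≡⟨ *-distribˡ-sum x (λ e → c (suc e) * (x ^F toℕ e)) ⟩
    sum (λ e → x * (c (suc e) * (x ^F toℕ e)))      ≡⟨ sum-cong-≗ (λ e → *-left-swap x (c (suc e)) _) ⟩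
    sum (λ e → c (suc e) * (x * (x ^F toℕ e)))      ∎)

  univariate-vanishing : (c : Fin q → F) → (∀ x → sum (λ e → c e * (x ^F toℕ e)) ≡ 0#) → ∀ e → c e ≡ 0#
  univariate-vanishing c vanish e = trans (sym (VecP.lookup∘tabulate c e))
    (distinct-roots q (tabulate c) element (λ i j → element-injective)
      (λ i → trans (horner-tabulate c (element i)) (vanish (element i))) e)

  Exponents : ℕ → Set
  Exponents k = Vec (Fin q) k

  sumExp : ∀ {k} → (Exponents k → F) → F
  sumExp {zero} h = h []
  sumExp {suc k} h = sum (λ i → sumExp (λ a → h (i ∷ a)))

  sumExp-cong : ∀ {k} {f g : Exponents k → F} → (∀ a → f a ≡ g a) → sumExp f ≡ sumExp g
  sumExp-cong {zero} h = h []
  sumExp-cong {suc k} h = sum-cong-≗ (λ i → sumExp-cong (λ a → h (i ∷ a)))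

  sumExp-zero : ∀ {k} (f : Exponents k → F) → (∀ a → f a ≡ 0#) → sumExp f ≡ 0#
  sumExp-zero {zero} f h = h []
  sumExp-zero {suc k} f h = trans (sum-cong-≗ (λ i → sumExp-zero _ (λ a → h (i ∷ a)))) (sum-replicate-zero q)

  sumExp-+ : ∀ {k} (f g : Exponents k → F) → sumExp (λ a → f a + g a) ≡ sumExp f + sumExp g
  sumExp-+ {zero} f g = refl
  sumExp-+ {suc k} f g = trans (sum-cong-≗ (λ i → sumExp-+ (λ a → f (i ∷ a)) (λ a → g (i ∷ a)))) (∑-distrib-+ (λ i → sumExp (λ a → f (i ∷ a))) (λ i → sumExp (λ a → g (i ∷ a))))

  sumExp-scale : ∀ {k} c (f : Exponents k → F) → c * sumExp f ≡ sumExp (λ a → c * f a)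
  sumExp-scale {zero} c f = refl
  sumExp-scale {suc k} c f = trans (*-distribˡ-sum c (λ i → sumExp (λ a → f (i ∷ a)))) (sum-cong-≗ (λ i → sumExp-scale c (λ a → f (i ∷ a))))

  sumExp-single : ∀ {k} (f : Exponents k → F) b → (∀ a → a ≢ b → f a ≡ 0#) → sumExp f ≡ f b
  sumExp-single {zero} f [] h = refl
  sumExp-single {suc k} f (i₀ ∷ b) h = trans (sum-single _ i₀ other-heads)
      (sumExp-single _ b (λ a a≢b → h (i₀ ∷ a) (λ e → a≢b (VecP.∷-injectiveʳ e))))
    where
    other-heads : ∀ i → i ≢ i₀ → sumExp (λ a → f (i ∷ a)) ≡ 0#
    other-heads i i≢i₀ = sumExp-zero _ (λ a → h (i ∷ a) (λ e → i≢i₀ (VecP.∷-injectiveˡ e)))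

  power : ∀ {k} → Exponents k → Vec F k → F
  power a v = evalMono (Vec.map toℕ a) v

  -- Induction on k: for fixed tail v, the first variable x
  -- enters as a univariate polynomial with coefficients D v e.
  reduced-vanishing : ∀ {k} (R : Exponents k → F) → (∀ v → sumExp (λ a → R a * power a v) ≡ 0#) → ∀ a → R a ≡ 0#
  reduced-vanishing {zero} R vanish [] = trans (sym (*-identityʳ (R []))) (vanish [])
  reduced-vanishing {suc k} R vanish (i ∷ a) =
    reduced-vanishing (λ a′ → R (i ∷ a′)) (λ v → univariate-vanishing (D v) (vanish-in-x v) i) a
    where
    D : Vec F k → Fin q → F
    D v e = sumExp (λ a′ → R (e ∷ a′) * power a′ v)
    vanish-in-x : ∀ v x → sum (λ e → D v e * (x ^F toℕ e)) ≡ 0#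
    vanish-in-x v x = trans (sum-cong-≗ regroup) (vanish (x ∷ v))
      where
      regroup : ∀ e → D v e * (x ^F toℕ e) ≡ sumExp (λ a′ → R (e ∷ a′) * ((x ^F toℕ e) * power a′ v))
      regroup e = trans (*-comm (D v e) _) (trans (sumExp-scale (x ^F toℕ e) (λ a′ → R (e ∷ a′) * power a′ v))
        (sumExp-cong (λ a′ → *-left-swap (x ^F toℕ e) (R (e ∷ a′)) _)))

module SystematicCode (K : Field) (q : ℕ) (card : Fin q ↔ Field.F K) (k r : ℕ)
       (φ : Vec (Field.F K) k → Vec (Field.F K) (k ℕ.+ r))
       (systematic : ∀ v → take k (φ v) ≡ v) where
  open FieldLemmas K
  open Poly K
  open Vars k r
  open PolynomialCalculus K
  open LexOrder K
  open FiniteField K q card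
  open ReducedPolynomialsVanish K q card
  open ≡-Reasoning

  N : ℕ
  N = k ℕ.+ r

  InI : Polynomial N → Set
  InI = VanishingIdeal φ

  split-variable : (t : Fin N) → (∃ λ i → t ≡ xVar i) ⊎ (∃ λ j → t ≡ zVar j)
  split-variable t with Fin.splitAt k t in eq
  ... | inj₁ i = inj₁ (i , trans (sym (FinP.join-splitAt k r t)) (cong (Fin.join k r) eq))
  ... | inj₂ j = inj₂ (j , trans (sym (FinP.join-splitAt k r t)) (cong (Fin.join k r) eq))

  x<z : ∀ i j → toℕ (xVar i) < toℕ (zVar j)
  x<z i j = subst₂ _<_ (sym (FinP.toℕ-↑ˡ i r)) (sym (FinP.toℕ-↑ʳ k j))
    (ℕP.<-≤-trans (FinP.toℕ<n i) (ℕP.m≤m+n k (toℕ j)))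

  x≢z : ∀ i j → xVar i ≢ zVar j
  x≢z i j e = ℕP.<-irrefl (cong toℕ e) (x<z i j)

  lookup-take : ∀ {A : Set} (u : Vec A N) i → lookup (take k u) i ≡ lookup u (xVar i)
  lookup-take u i = trans (sym (VecP.lookup-++ˡ (take k u) (drop k u) i))
    (cong (λ u′ → lookup u′ (xVar i)) (VecP.take++drop≡id k u))

  lookup-drop : ∀ {A : Set} (u : Vec A N) j → lookup (drop k u) j ≡ lookup u (zVar j)
  lookup-drop u j = trans (sym (VecP.lookup-++ʳ (take k u) (drop k u) j))
    (cong (λ u′ → lookup u′ (zVar j)) (VecP.take++drop≡id k u))

  lookup-φ-x : ∀ v i → lookup (φ v) (xVar i) ≡ lookup v i
  lookup-φ-x v i = trans (sym (lookup-take (φ v) i)) (cong (λ u → lookup u i) (systematic v))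

  ∈I--P : ∀ {p p′} → InI p → InI p′ → InI (p -P p′)
  ∈I--P {p} {p′} p∈I p′∈I v = trans (eval--P p p′ (φ v)) (trans (cong₂ _-_ (p∈I v) (p′∈I v)) (x-x≡0 0#))

  -- Monomials in the x-variables only, and standard monomials: those not
  -- divisible by any x_i^q or z_j.
  ZFree : Monomial N → Set
  ZFree m = ∀ j → lookup m (zVar j) ≡ 0

  Standard : Monomial N → Set
  Standard m = ZFree m × (∀ i → lookup m (xVar i) < q)

  zfree-unit : ZFree (replicate N 0)
  zfree-unit j = VecP.lookup-replicate (zVar j) 0

  zfree-+ : ∀ {m m′} → ZFree m → ZFree m′ → ZFree (zipWith ℕ._+_ m m′)
  zfree-+ {m} {m′} zm zm′ j = trans (VecP.lookup-zipWith ℕ._+_ (zVar j) m m′) (cong₂ ℕ._+_ (zm j) (zm′ j))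

  module ZFreePolynomials = MonomialSubmonoid ZFree zfree-unit (λ {m} {m′} → zfree-+ {m} {m′})

  zfree-x : ∀ i e → ZFree (varPow (xVar i) e)
  zfree-x i e j = lookup-varPow-other (xVar i) (zVar j) e (λ z≡x → x≢z i j (sym z≡x))

  -- Monomials lex-below a z-free monomial are z-free (the z's are the most
  -- significant variables).
  ≤lex-zfree : ∀ {m M} → m ≤lex M → ZFree M → ZFree m
  ≤lex-zfree (inj₁ refl) zM = zM
  ≤lex-zfree {m} {M} (inj₂ (t , mₜ<Mₜ , above)) zM j with split-variable t
  ... | inj₁ (i , refl) = trans (above (zVar j) (x<z i j)) (zM j)
  ... | inj₂ (j′ , refl) = ⊥-elim (ℕP.n≮0 (subst (lookup m (zVar j′) <_) (zM j′) mₜ<Mₜ))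

  evalMono-zfree : ∀ m → ZFree m → ∀ v → evalMono m (φ v) ≡ evalMono (take k m) v
  evalMono-zfree m zm v = begin
    evalMono m (φ v)
      ≡⟨ cong₂ evalMono (sym (VecP.take++drop≡id k m)) (sym (VecP.take++drop≡id k (φ v))) ⟩
    evalMono (take k m Vec.++ drop k m) (take k (φ v) Vec.++ drop k (φ v))
      ≡⟨ evalMono-++ (take k m) (drop k m) _ _ ⟩
    evalMono (take k m) (take k (φ v)) * evalMono (drop k m) (drop k (φ v))
      ≡⟨ cong₂ _*_ (cong (evalMono (take k m)) (systematic v))
                   (trans (cong (λ m′ → evalMono m′ (drop k (φ v))) drop≡0) (evalMono-unit (drop k (φ v)))) ⟩
    evalMono (take k m) v * 1#
      ≡⟨ *-identityʳ _ ⟩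
    evalMono (take k m) v ∎
    where
    drop≡0 : drop k m ≡ replicate r 0
    drop≡0 = vec-ext (λ j → trans (lookup-drop m j) (trans (zm j) (sym (VecP.lookup-replicate j 0))))

  reduceFin : ℕ → Fin q
  reduceFin e = fromℕ< (reduce<q e)

  reduced : Monomial N → Exponents k
  reduced m = Vec.map reduceFin (take k m)

  toℕ-reduced : ∀ m i → toℕ (lookup (reduced m) i) ≡ reduce (lookup m (xVar i))
  toℕ-reduced m i = trans (cong toℕ (VecP.lookup-map i reduceFin (take k m)))
    (trans (FinP.toℕ-fromℕ< (reduce<q (lookup (take k m) i))) (cong reduce (lookup-take m i)))

  evalMono-reduce : ∀ {n} (es : Vec ℕ n) v → evalMono (Vec.map toℕ (Vec.map reduceFin es)) v ≡ evalMono es v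
  evalMono-reduce [] [] = refl
  evalMono-reduce (e ∷ es) (x ∷ v) =
    cong₂ _*_ (trans (cong (x ^F_) (FinP.toℕ-fromℕ< (reduce<q e))) (^F-reduce x e)) (evalMono-reduce es v)

  evalMono-reduced : ∀ m → ZFree m → ∀ v → evalMono m (φ v) ≡ power (reduced m) v
  evalMono-reduced m zm v = trans (evalMono-zfree m zm v) (sym (evalMono-reduce (take k m) v))

  indicator : Exponents k → Exponents k → F
  indicator a b with VecP.≡-dec FinP._≟_ a b
  ... | yes _ = 1#
  ... | no _ = 0#

  indicator-same : ∀ a → indicator a a ≡ 1#
  indicator-same a with VecP.≡-dec FinP._≟_ a a
  ... | yes _ = refl
  ... | no a≢a = ⊥-elim (a≢a refl)

  indicator-other : ∀ a b → a ≢ b → indicator a b ≡ 0#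
  indicator-other a b a≢b with VecP.≡-dec FinP._≟_ a b
  ... | yes a≡b = ⊥-elim (a≢b a≡b)
  ... | no _ = refl

  weigh-sumExp : ∀ (p : Polynomial N) (h : Monomial N → Exponents k → F) →
    weigh p (λ m → sumExp (h m)) ≡ sumExp (λ a → weigh p (λ m → h m a))
  weigh-sumExp [] h = sym (sumExp-zero {k} (λ _ → 0#) (λ _ → refl))
  weigh-sumExp ((c , m) ∷ p) h = trans (cong₂ _+_ (sumExp-scale c (h m)) (weigh-sumExp p h))
    (sym (sumExp-+ (λ a → c * h m a) (λ a → weigh p (λ m → h m a))))

  -- The coefficient of v^a after reducing all exponents of f below q.
  grouped : Polynomial N → Exponents k → F
  grouped f a = weigh f (λ m → indicator (reduced m) a)

  eval-grouped : ∀ f → (∀ m → coeff f m ≢ 0# → ZFree m) → ∀ v →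
    eval f (φ v) ≡ sumExp (λ a → grouped f a * power a v)
  eval-grouped f zf v = begin
    eval f (φ v)                                          ≡⟨ eval≡weigh f (φ v) ⟩
    weigh f (λ m → evalMono m (φ v))                       ≡⟨ weigh-cong f _ _ (λ m c≢0 → evalMono-reduced m (zf m c≢0) v) ⟩
    weigh f (λ m → power (reduced m) v)                    ≡⟨ weigh-cong f _ _ (λ m _ → sym (select m)) ⟩
    weigh f (λ m → sumExp (λ a → indicator (reduced m) a * power a v)) ≡⟨ weigh-sumExp f _ ⟩
    sumExp (λ a → weigh f (λ m → indicator (reduced m) a * power a v)) ≡⟨ sumExp-cong (λ a → weigh-*ʳ f _ (power a v)) ⟩
    sumExp (λ a → grouped f a * power a v)                ∎
    where
    select : ∀ m → sumExp (λ a → indicator (reduced m) a * power a v) ≡ power (reduced m) v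
    select m = trans (sumExp-single _ (reduced m) (λ a a≢ → trans (cong (_* power a v) (indicator-other _ a (λ e → a≢ (sym e)))) (zeroˡ _)))
      (trans (cong (_* power (reduced m) v) (indicator-same (reduced m))) (*-identityˡ _))

  isolated-coefficient-vanishes : ∀ f → InI f → (∀ m → coeff f m ≢ 0# → ZFree m) → ∀ M →
    (∀ m → m ≢ M → coeff f m ≢ 0# → reduced m ≢ reduced M) → coeff f M ≡ 0#
  isolated-coefficient-vanishes f f∈I zf M isolated = begin
    coeff f M                                  ≡⟨ sym (*-identityʳ _) ⟩
    coeff f M * 1#                             ≡⟨ cong (coeff f M *_) (sym (indicator-same (reduced M))) ⟩
    coeff f M * indicator (reduced M) (reduced M) ≡⟨ sym (weigh-single f _ M only-M) ⟩
    grouped f (reduced M)                      ≡⟨ reduced-vanishing (grouped f) (λ v → trans (sym (eval-grouped f zf v)) (f∈I v)) (reduced M) ⟩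
    0#                                         ∎
    where
    only-M : ∀ m → m ≢ M → coeff f m ≡ 0# ⊎ indicator (reduced m) (reduced M) ≡ 0#
    only-M m m≢M with coeff f m ≟ 0#
    ... | yes c≡0 = inj₁ c≡0
    ... | no c≢0 = inj₂ (indicator-other _ _ (isolated m m≢M c≢0))

  reduce-x : ∀ {m M} → reduced m ≡ reduced M → ∀ i → reduce (lookup m (xVar i)) ≡ reduce (lookup M (xVar i))
  reduce-x {m} {M} e i = trans (sym (toℕ-reduced m i)) (trans (cong (λ a → toℕ (lookup a i)) e) (toℕ-reduced M i))

  standard-vanishes : ∀ f → InI f → (∀ m → coeff f m ≢ 0# → Standard m) → ∀ M → coeff f M ≡ 0#
  standard-vanishes f f∈I std M with coeff f M ≟ 0#
  ... | yes c≡0 = c≡0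
  ... | no c≢0 = isolated-coefficient-vanishes f f∈I (λ m c≢0 → proj₁ (std m c≢0)) M separated
    where
    -- standard monomials are determined by their reduced exponents
    separated : ∀ m → m ≢ M → coeff f m ≢ 0# → reduced m ≢ reduced M
    separated m m≢M cₘ≢0 e = m≢M (vec-ext same-entry)
      where
      same-entry : ∀ t → lookup m t ≡ lookup M t
      same-entry t with split-variable t
      ... | inj₁ (i , refl) = trans (sym (reduce-id _ (proj₂ (std m cₘ≢0) i)))
                                (trans (reduce-x e i) (reduce-id _ (proj₂ (std M c≢0) i)))
      ... | inj₂ (j , refl) = trans (proj₁ (std m cₘ≢0) j) (sym (proj₁ (std M c≢0) j))

  -- Its monomials are
  -- lex-below M, hence z-free; one with the same reduced exponents as M
  -- would be divisible by M (reduction only lowers exponents), hence ≥lex M.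
  leading-not-standard : ∀ f → InI f → ∀ M → IsLeadingMonomial f M → Standard M → ⊥
  leading-not-standard f f∈I M (c≢0 , below) std =
    c≢0 (isolated-coefficient-vanishes f f∈I (λ m cₘ≢0 → ≤lex-zfree (below m cₘ≢0) (proj₁ std)) M separated)
    where
    separated : ∀ m → m ≢ M → coeff f m ≢ 0# → reduced m ≢ reduced M
    separated m m≢M cₘ≢0 e = m≢M (sym (∣M-≥lex⇒≡ (∣M-intro M≤m) (below m cₘ≢0)))
      where
      M≤m : ∀ t → lookup M t ≤ lookup m t
      M≤m t with split-variable t
      ... | inj₁ (i , refl) = subst (_≤ lookup m (xVar i))
                                (trans (reduce-x e i) (reduce-id _ (proj₂ std i))) (reduce≤ _)
      ... | inj₂ (j , refl) = subst (_≤ lookup m (zVar j)) (sym (proj₁ std j)) z≤n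

  xCoordinate : Fin k → Polynomial N
  xCoordinate i = term 1# (varPow (xVar i) 1)

  eval-xCoordinate : ∀ i v → eval (xCoordinate i) (φ v) ≡ lookup v i
  eval-xCoordinate i v = begin
    eval (xCoordinate i) (φ v)              ≡⟨ eval-term 1# (varPow (xVar i) 1) (φ v) ⟩
    1# * evalMono (varPow (xVar i) 1) (φ v) ≡⟨ *-identityˡ _ ⟩
    evalMono (varPow (xVar i) 1) (φ v)      ≡⟨ evalMono-varPow (xVar i) 1 (φ v) ⟩
    lookup (φ v) (xVar i) * 1#              ≡⟨ *-identityʳ _ ⟩
    lookup (φ v) (xVar i)                   ≡⟨ lookup-φ-x v i ⟩
    lookup v i                              ∎

  -- The Lagrange factor 1 - (x_i - b)^(q-1): on codewords it is 1 where
  -- v_i = b and 0 elsewhere, since nonzero elements are (q-1)-th roots of 1.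
  lagrange : F → Fin k → Polynomial N
  lagrange b i = constP 1# -P ((xCoordinate i -P constP b) ^P (q ∸ 1))

  eval-lagrange : ∀ b i v → eval (lagrange b i) (φ v) ≡ 1# - (lookup v i - b) ^F (q ∸ 1)
  eval-lagrange b i v = trans (eval--P (constP 1#) ((xCoordinate i -P constP b) ^P (q ∸ 1)) (φ v)) (cong₂ _-_ (eval-constP 1# (φ v))
    (trans (eval-^P (xCoordinate i -P constP b) (q ∸ 1) (φ v)) (cong (_^F (q ∸ 1))
      (trans (eval--P (xCoordinate i) (constP b) (φ v)) (cong₂ _-_ (eval-xCoordinate i v) (eval-constP b (φ v)))))))

  lagrange-same : ∀ b i v → lookup v i ≡ b → eval (lagrange b i) (φ v) ≡ 1#
  lagrange-same b i v vᵢ≡b = begin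
    eval (lagrange b i) (φ v)        ≡⟨ eval-lagrange b i v ⟩
    1# - (lookup v i - b) ^F (q ∸ 1) ≡⟨ cong (λ t → 1# - t ^F (q ∸ 1)) (trans (cong (_- b) vᵢ≡b) (x-x≡0 b)) ⟩
    1# - 0# ^F (q ∸ 1)               ≡⟨ cong (λ t → 1# - t) (0^F-pos (q ∸ 1) 0<q-1) ⟩
    1# - 0#                          ≡⟨ x-0≡x 1# ⟩
    1#                               ∎

  lagrange-other : ∀ b i v → lookup v i ≢ b → eval (lagrange b i) (φ v) ≡ 0#
  lagrange-other b i v vᵢ≢b = trans (eval-lagrange b i v)
    (trans (cong (λ t → 1# - t) (pow-q-1 _ (λ d≡0 → vᵢ≢b (x-y≡0⇒x≡y _ _ d≡0)))) (x-x≡0 1#))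

  zfree-lagrange : ∀ b i → AllMonomials ZFree (lagrange b i)
  zfree-lagrange b i = allMonomials--P (closed-constP 1#)
      (closed-^P (q ∸ 1) (allMonomials--P (zfree-x i 1 All.∷ All.[]) (closed-constP b)))
    where open ZFreePolynomials

  pointIndicator : Vec F k → Polynomial N
  pointIndicator w = ∏P (λ i → lagrange (lookup w i) i)

  pointIndicator-same : ∀ v → eval (pointIndicator v) (φ v) ≡ 1#
  pointIndicator-same v = trans (eval-∏P (λ i → lagrange (lookup v i) i) (φ v))
    (trans (Product.sum-cong-≗ (λ i → lagrange-same (lookup v i) i v refl)) (Product.sum-replicate-zero k))

  pointIndicator-other : ∀ v w → v ≢ w → eval (pointIndicator w) (φ v) ≡ 0#
  pointIndicator-other v w v≢w with FinP.¬∀⟶∃¬ k _ (λ i → lookup v i ≟ lookup w i) (λ same → v≢w (vec-ext same))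
  ... | i , vᵢ≢wᵢ = trans (eval-∏P (λ i → lagrange (lookup w i) i) (φ v)) (prod-≡0 (λ i → eval (lagrange (lookup w i) i) (φ v)) i (lagrange-other (lookup w i) i v vᵢ≢wᵢ))

  ∑PExp : ∀ {n} → (Exponents n → Polynomial N) → Polynomial N
  ∑PExp {zero} P = P []
  ∑PExp {suc n} P = ∑P (λ i → ∑PExp (λ a → P (i ∷ a)))

  eval-∑PExp : ∀ {n} (P : Exponents n → Polynomial N) u → eval (∑PExp P) u ≡ sumExp (λ a → eval (P a) u)
  eval-∑PExp {zero} P u = refl
  eval-∑PExp {suc n} P u =
    trans (eval-∑P (λ i → ∑PExp (λ a → P (i ∷ a))) u) (sum-cong-≗ (λ i → eval-∑PExp (λ a → P (i ∷ a)) u))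

  zfree-∑PExp : ∀ {n} (P : Exponents n → Polynomial N) → (∀ a → AllMonomials ZFree (P a)) →
    AllMonomials ZFree (∑PExp P)
  zfree-∑PExp {zero} P zP = zP []
  zfree-∑PExp {suc n} P zP =
    ZFreePolynomials.closed-∑P _ (λ i → zfree-∑PExp (λ a → P (i ∷ a)) (λ a → zP (i ∷ a)))

  -- Every function h on messages is, on codewords, a polynomial in the x's:
  -- the sum over all points w of h w times the indicator of w.
  point : Exponents k → Vec F k
  point = Vec.map element

  interpolate : (Vec F k → F) → Polynomial N
  interpolate h = ∑PExp (λ a → scaleP (h (point a)) (pointIndicator (point a)))

  zfree-interpolate : ∀ h → AllMonomials ZFree (interpolate h)
  zfree-interpolate h = zfree-∑PExp _ (λ a →
    closed-scaleP (closed-∏P _ (λ i → zfree-lagrange (lookup (point a) i) i)))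
    where open ZFreePolynomials

  eval-interpolate : ∀ h v → eval (interpolate h) (φ v) ≡ h v
  eval-interpolate h v = begin
    eval (interpolate h) (φ v)
      ≡⟨ eval-∑PExp (λ a → scaleP (h (point a)) (pointIndicator (point a))) (φ v) ⟩
    sumExp (λ a → eval (scaleP (h (point a)) (pointIndicator (point a))) (φ v))
      ≡⟨ sumExp-cong (λ a → eval-scaleP (h (point a)) (pointIndicator (point a)) (φ v)) ⟩
    sumExp (λ a → h (point a) * eval (pointIndicator (point a)) (φ v))
      ≡⟨ sumExp-single _ b other ⟩
    h (point b) * eval (pointIndicator (point b)) (φ v)
      ≡⟨ cong (λ w → h w * eval (pointIndicator w) (φ v)) point-b ⟩
    h v * eval (pointIndicator v) (φ v)
      ≡⟨ cong (h v *_) (pointIndicator-same v) ⟩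
    h v * 1#
      ≡⟨ *-identityʳ _ ⟩
    h v ∎
    where
    b = Vec.map index v
    point-b : point b ≡ v
    point-b = trans (sym (VecP.map-∘ element index v)) (trans (VecP.map-cong strictlyInverseˡ v) (VecP.map-id v))
    index-point : ∀ a → Vec.map index (point a) ≡ a
    index-point a = trans (sym (VecP.map-∘ index element a)) (trans (VecP.map-cong strictlyInverseʳ a) (VecP.map-id a))
    other : ∀ a → a ≢ b → h (point a) * eval (pointIndicator (point a)) (φ v) ≡ 0#
    other a a≢b = trans (cong (h (point a) *_) (pointIndicator-other v (point a) v≢point-a)) (zeroʳ _)
      where
      v≢point-a : v ≢ point a
      v≢point-a v≡ = a≢b (trans (sym (index-point a)) (cong (Vec.map index) (sym v≡)))

  fieldEquation : Fin k → Polynomial N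
  fieldEquation i = term 1# (varPow (xVar i) q) -P term 1# (varPow (xVar i) 1)

  eval-term-x : ∀ i e v → eval (term 1# (varPow (xVar i) e)) (φ v) ≡ lookup v i ^F e
  eval-term-x i e v = trans (eval-term 1# (varPow (xVar i) e) (φ v)) (trans (*-identityˡ _)
    (trans (evalMono-varPow (xVar i) e (φ v)) (cong (_^F e) (lookup-φ-x v i))))

  fieldEquation-∈I : ∀ i → InI (fieldEquation i)
  fieldEquation-∈I i v = begin
    eval (fieldEquation i) (φ v)
      ≡⟨ eval--P (term 1# (varPow (xVar i) q)) (term 1# (varPow (xVar i) 1)) (φ v) ⟩
    eval (term 1# (varPow (xVar i) q)) (φ v) - eval (term 1# (varPow (xVar i) 1)) (φ v)
      ≡⟨ cong₂ _-_ (trans (eval-term-x i q v) (fermat _)) (eval-term-x i 1 v) ⟩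
    lookup v i - lookup v i * 1#               ≡⟨ cong (λ t → lookup v i - t) (*-identityʳ _) ⟩
    lookup v i - lookup v i                    ≡⟨ x-x≡0 _ ⟩
    0#                                         ∎

  x^q≢x : ∀ i → varPow (xVar i) q ≢ varPow (xVar i) 1
  x^q≢x i e = ℕP.<-irrefl (sym (trans (sym (lookup-varPow-same (xVar i) q))
    (trans (cong (λ m → lookup m (xVar i)) e) (lookup-varPow-same (xVar i) 1)))) 2≤q

  fieldEquation-monic : ∀ i → coeff (fieldEquation i) (varPow (xVar i) q) ≡ 1#
  fieldEquation-monic i = trans (coeff--P (term 1# xᵢ^q) (term 1# xᵢ) xᵢ^q) (trans (cong₂ _-_ (coeff-term-same 1# xᵢ^q)
      (coeff-term-other 1# xᵢ xᵢ^q (λ e → x^q≢x i (sym e)))) (x-0≡x 1#))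
    where
    xᵢ^q = varPow (xVar i) q
    xᵢ = varPow (xVar i) 1

  fieldEquation-support : ∀ i m → coeff (fieldEquation i) m ≢ 0# → m ≡ varPow (xVar i) q ⊎ m ≡ varPow (xVar i) 1
  fieldEquation-support i = support-AllMonomials (fieldEquation i) (inj₁ refl All.∷ inj₂ refl All.∷ All.[])

  fieldEquation-leading : ∀ i → IsLeadingMonomial (fieldEquation i) (varPow (xVar i) q)
  fieldEquation-leading i = (λ e → 1≢0 (trans (sym (fieldEquation-monic i)) e)) , below
    where
    below : ∀ m → coeff (fieldEquation i) m ≢ 0# → m ≤lex varPow (xVar i) q
    below m c≢0 with fieldEquation-support i m c≢0
    ... | inj₁ refl = inj₁ refl
    ... | inj₂ refl = inj₂ (varPow-<lex (xVar i) 2≤q)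

  x-standard : ∀ i → Standard (varPow (xVar i) 1)
  x-standard i = zfree-x i 1 , below-q
    where
    below-q : ∀ i′ → lookup (varPow (xVar i) 1) (xVar i′) < q
    below-q i′ with xVar i′ FinP.≟ xVar i
    ... | yes x≡x = subst (_< q) (sym (trans (cong (lookup (varPow (xVar i) 1)) x≡x) (lookup-varPow-same (xVar i) 1))) 2≤q
    ... | no i′≢i = subst (_< q) (sym (lookup-varPow-other (xVar i) (xVar i′) 1 i′≢i)) 0<q

  redundancy : Fin r → Vec F k → F
  redundancy j v = lookup (φ v) (zVar j)

  codeEquation : Fin r → Polynomial N
  codeEquation j = term 1# (varPow (zVar j) 1) -P interpolate (redundancy j)

  codeEquation-∈I : ∀ j → InI (codeEquation j)
  codeEquation-∈I j v = begin
    eval (codeEquation j) (φ v)                              ≡⟨ eval--P (term 1# (varPow (zVar j) 1)) (interpolate (redundancy j)) (φ v) ⟩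
    eval (term 1# (varPow (zVar j) 1)) (φ v) - eval (interpolate (redundancy j)) (φ v)
      ≡⟨ cong₂ _-_ z-value (eval-interpolate (redundancy j) v) ⟩
    redundancy j v - redundancy j v                          ≡⟨ x-x≡0 _ ⟩
    0#                                                       ∎
    where
    z-value : eval (term 1# (varPow (zVar j) 1)) (φ v) ≡ redundancy j v
    z-value = trans (eval-term 1# (varPow (zVar j) 1) (φ v)) (trans (*-identityˡ _)
      (trans (evalMono-varPow (zVar j) 1 (φ v)) (*-identityʳ _)))

  z-not-zfree : ∀ j → ZFree (varPow (zVar j) 1) → ⊥
  z-not-zfree j zf with trans (sym (lookup-varPow-same (zVar j) 1)) (zf j)
  ... | ()

  zfree-<lex-z : ∀ j m → ZFree m → m <lex varPow (zVar j) 1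
  zfree-<lex-z j m zm = zVar j , subst₂ _<_ (sym (zm j)) (sym (lookup-varPow-same (zVar j) 1)) (s≤s z≤n) , above
    where
    above : ∀ t → toℕ (zVar j) < toℕ t → lookup m t ≡ lookup (varPow (zVar j) 1) t
    above t z<t with split-variable t
    ... | inj₁ (i , refl) = ⊥-elim (ℕP.<-asym z<t (x<z i j))
    ... | inj₂ (j′ , refl) = trans (zm j′)
      (sym (lookup-varPow-other (zVar j) (zVar j′) 1 (λ e → ℕP.<-irrefl (cong toℕ (sym e)) z<t)))

  codeEquation-leading : ∀ j → IsLeadingMonomial (codeEquation j) (varPow (zVar j) 1)
  codeEquation-leading j = leading≢0 , below
    where
    zⱼ = varPow (zVar j) 1
    interpolant-coeff : coeff (interpolate (redundancy j)) zⱼ ≡ 0#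
    interpolant-coeff with coeff (interpolate (redundancy j)) zⱼ ≟ 0#
    ... | yes c≡0 = c≡0
    ... | no c≢0 = ⊥-elim (z-not-zfree j (support-AllMonomials _ (zfree-interpolate (redundancy j)) zⱼ c≢0))
    leading≡1 : coeff (codeEquation j) zⱼ ≡ 1#
    leading≡1 = trans (coeff--P (term 1# zⱼ) _ zⱼ)
      (trans (cong₂ _-_ (coeff-term-same 1# zⱼ) interpolant-coeff) (x-0≡x 1#))
    leading≢0 : coeff (codeEquation j) zⱼ ≢ 0#
    leading≢0 e = 1≢0 (trans (sym leading≡1) e)
    z-or-zfree : AllMonomials (λ m → m ≡ zⱼ ⊎ ZFree m) (codeEquation j)
    z-or-zfree = inj₁ refl All.∷ allMonomials-negP (All.map inj₂ (zfree-interpolate (redundancy j)))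
    below : ∀ m → coeff (codeEquation j) m ≢ 0# → m ≤lex zⱼ
    below m c≢0 with support-AllMonomials (codeEquation j) z-or-zfree m c≢0
    ... | inj₁ refl = inj₁ refl
    ... | inj₂ zm = inj₂ (zfree-<lex-z j m zm)

-- Its leading monomials cover x_i^q and z_j (the leading
-- monomials of the explicit elements), so every monomial not divisible by one
-- of them is standard; by interreducedness every non-leading monomial of a
-- basis element is standard, and every leading monomial is some x_i^q or
-- z_j.  Comparing with the explicit elements then pins down each g ∈ G.
module ReducedBasisOfCode (K : Field) (q : ℕ) (card : Fin q ↔ Field.F K) (k r : ℕ)
       (φ : Vec (Field.F K) k → Vec (Field.F K) (k ℕ.+ r))
       (systematic : ∀ v → take k (φ v) ≡ v)
       (G : List (Poly.Polynomial K (k ℕ.+ r)))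
       (reduced-basis : Poly.IsReducedGroebnerBasis K (Poly.VanishingIdeal K φ) G) where
  open FieldLemmas K
  open Poly K
  open Vars k r
  open PolynomialCalculus K
  open LexOrder K
  open FiniteField K q card using (0<q)
  open SystematicCode K q card k r φ systematic

  Index : Set
  Index = Fin (length G)

  g : Index → Polynomial N
  g = List.lookup G

  lm : Index → Monomial N
  lm t = proj₁ (proj₁ (proj₂ reduced-basis) t)

  lm-leading : ∀ t → IsLeadingMonomial (g t) (lm t)
  lm-leading t = proj₁ (proj₂ (proj₁ (proj₂ reduced-basis) t))

  lm-monic : ∀ t → coeff (g t) (lm t) ≡ 1#
  lm-monic t = proj₂ (proj₂ (proj₁ (proj₂ reduced-basis) t))

  interreduced : ∀ t s → t ≢ s → ∀ m → coeff (g t) m ≢ 0# → ¬ (lm s ∣M m)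
  interreduced t s t≢s m c≢0 = proj₂ (proj₂ reduced-basis) t s t≢s m c≢0 (lm s) (lm-leading s)

  g-∈I : ∀ t → InI (g t)
  g-∈I t = All.lookup (proj₁ (proj₁ reduced-basis)) (∈-lookup t)

  divisible-leading : ∀ f → InI f → ∀ M → IsLeadingMonomial f M → ∃ λ t → lm t ∣M M
  divisible-leading f f∈I M M-leading = t , subst₂ _∣M_ lm≡ M≡ divides
    where
    found = proj₂ (proj₁ reduced-basis) f f∈I (M , proj₁ M-leading)
    t = Any.index found
    witness : ∃[ mg ] ∃[ mf ] (IsLeadingMonomial (g t) mg × IsLeadingMonomial f mf × mg ∣M mf)
    witness = AnyP.lookup-index found
    lm≡ = leading-monomial-unique {p = g t} (proj₁ (proj₂ (proj₂ witness))) (lm-leading t)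
    M≡ = leading-monomial-unique {p = f} (proj₁ (proj₂ (proj₂ (proj₂ witness)))) M-leading
    divides = proj₂ (proj₂ (proj₂ (proj₂ witness)))

  lm-divides-lm : ∀ t s → lm s ∣M lm t → t ≡ s
  lm-divides-lm t s d with t FinP.≟ s
  ... | yes t≡s = t≡s
  ... | no t≢s = ⊥-elim (interreduced t s t≢s (lm t) (proj₁ (lm-leading t)) d)

  divisor-of-power : ∀ {m} (v : Fin N) e → m ∣M varPow v e →
    m ≡ varPow v e ⊎ (lookup m v < e × (∀ t → t ≢ v → lookup m t ≡ 0))
  divisor-of-power {m} v e m∣vᵉ with lookup m v ℕ.≟ e
  ... | yes mᵥ≡e = inj₁ (vec-ext entry)
    where
    entry : ∀ t → lookup m t ≡ lookup (varPow v e) t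
    entry t with t FinP.≟ v
    ... | yes refl = trans mᵥ≡e (sym (lookup-varPow-same v e))
    ... | no t≢v = trans (zero-elsewhere t t≢v) (sym (lookup-varPow-other v t e t≢v))
      where
      zero-elsewhere : ∀ t → t ≢ v → lookup m t ≡ 0
      zero-elsewhere t t≢v = ℕP.n≤0⇒n≡0 (subst (lookup m t ≤_) (lookup-varPow-other v t e t≢v) (PW.lookup m∣vᵉ t))
  ... | no mᵥ≢e = inj₂ (ℕP.≤∧≢⇒< mᵥ≤e mᵥ≢e , zero-elsewhere)
    where
    mᵥ≤e : lookup m v ≤ e
    mᵥ≤e = subst (lookup m v ≤_) (lookup-varPow-same v e) (PW.lookup m∣vᵉ v)
    zero-elsewhere : ∀ t → t ≢ v → lookup m t ≡ 0
    zero-elsewhere t t≢v = ℕP.n≤0⇒n≡0 (subst (lookup m t ≤_) (lookup-varPow-other v t e t≢v) (PW.lookup m∣vᵉ t))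

  power-in-basis : ∀ f v e → InI f → IsLeadingMonomial f (varPow v e) →
    (∀ m → lookup m v < e → (∀ t → t ≢ v → lookup m t ≡ 0) → Standard m) →
    Σ Index λ t → lm t ≡ varPow v e
  power-in-basis f v e f∈I leading small-standard with divisible-leading f f∈I (varPow v e) leading
  ... | t , lm∣vᵉ with divisor-of-power v e lm∣vᵉ
  ...   | inj₁ lm≡vᵉ = t , lm≡vᵉ
  ...   | inj₂ (below , zero-elsewhere) =
    ⊥-elim (leading-not-standard (g t) (g-∈I t) (lm t) (lm-leading t) (small-standard (lm t) below zero-elsewhere))

  -- Opaque: only the existence of these elements matters, and unfolding their
  -- proofs would make type checking of the uses below very expensive.
  opaque
    x-power-basis : ∀ i → Σ Index λ t → lm t ≡ varPow (xVar i) q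
    x-power-basis i = power-in-basis (fieldEquation i) (xVar i) q (fieldEquation-∈I i) (fieldEquation-leading i) standard
      where
      standard : ∀ m → lookup m (xVar i) < q → (∀ t → t ≢ xVar i → lookup m t ≡ 0) → Standard m
      standard m mᵢ<q zero-elsewhere = (λ j → zero-elsewhere (zVar j) (λ z≡x → x≢z i j (sym z≡x))) , below-q
        where
        below-q : ∀ i′ → lookup m (xVar i′) < q
        below-q i′ with xVar i′ FinP.≟ xVar i
        ... | yes x≡x = subst (λ t → lookup m t < q) (sym x≡x) mᵢ<q
        ... | no i′≢i = subst (_< q) (sym (zero-elsewhere (xVar i′) i′≢i)) 0<q

    z-basis : ∀ j → Σ Index λ t → lm t ≡ varPow (zVar j) 1
    z-basis j = power-in-basis (codeEquation j) (zVar j) 1 (codeEquation-∈I j) (codeEquation-leading j) standard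
      where
      standard : ∀ m → lookup m (zVar j) < 1 → (∀ t → t ≢ zVar j → lookup m t ≡ 0) → Standard m
      standard m mⱼ<1 zero-elsewhere = (λ j′ → all-zero (zVar j′)) , (λ i → subst (_< q) (sym (all-zero (xVar i))) 0<q)
        where
        all-zero : ∀ t → lookup m t ≡ 0
        all-zero t with t FinP.≟ zVar j
        ... | yes refl = ℕP.n<1⇒n≡0 mⱼ<1
        ... | no t≢z = zero-elsewhere t t≢z

  x-index : Fin k → Index
  x-index i = proj₁ (x-power-basis i)

  z-index : Fin r → Index
  z-index j = proj₁ (z-basis j)

  varPow-∣M : ∀ {m} (v : Fin N) e → e ≤ lookup m v → varPow v e ∣M m
  varPow-∣M {m} v e e≤mᵥ = ∣M-intro entry
    where
    entry : ∀ t → lookup (varPow v e) t ≤ lookup m t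
    entry t with t FinP.≟ v
    ... | yes refl = subst (_≤ lookup m t) (sym (lookup-varPow-same v e)) e≤mᵥ
    ... | no t≢v = subst (_≤ lookup m t) (sym (lookup-varPow-other v t e t≢v)) z≤n

  standard-or-divisible : ∀ m → Standard m ⊎
    ((∃ λ i → varPow (xVar i) q ∣M m) ⊎ (∃ λ j → varPow (zVar j) 1 ∣M m))
  standard-or-divisible m with FinP.any? (λ i → q ℕ.≤? lookup m (xVar i)) | FinP.any? (λ j → 1 ℕ.≤? lookup m (zVar j))
  ... | yes (i , q≤mᵢ) | _ = inj₂ (inj₁ (i , varPow-∣M (xVar i) q q≤mᵢ))
  ... | no _ | yes (j , 1≤mⱼ) = inj₂ (inj₂ (j , varPow-∣M (zVar j) 1 1≤mⱼ))
  ... | no no-x | no no-z =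
    inj₁ ((λ j → ℕP.n<1⇒n≡0 (ℕP.≰⇒> (λ 1≤mⱼ → no-z (j , 1≤mⱼ)))) , (λ i → ℕP.≰⇒> (λ q≤mᵢ → no-x (i , q≤mᵢ))))

  -- A non-leading monomial of a basis element is divisible by no leading
  -- monomial of G (for its own element: it is lex-below it).
  non-leading-not-divisible : ∀ t m → coeff (g t) m ≢ 0# → m ≢ lm t → ∀ s → ¬ (lm s ∣M m)
  non-leading-not-divisible t m c≢0 m≢lm s d with t FinP.≟ s
  ... | yes refl = m≢lm (sym (∣M-≥lex⇒≡ d (proj₂ (lm-leading t) m c≢0)))
  ... | no t≢s = interreduced t s t≢s m c≢0 d

  non-leading-standard : ∀ t m → coeff (g t) m ≢ 0# → m ≢ lm t → Standard m
  non-leading-standard t m c≢0 m≢lm with standard-or-divisible m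
  ... | inj₁ std = std
  ... | inj₂ (inj₁ (i , d)) =
    ⊥-elim (not-divisible (x-index i) (subst (_∣M m) (sym (proj₂ (x-power-basis i))) d))
    where not-divisible = non-leading-not-divisible t m c≢0 m≢lm
  ... | inj₂ (inj₂ (j , d)) =
    ⊥-elim (not-divisible (z-index j) (subst (_∣M m) (sym (proj₂ (z-basis j))) d))
    where not-divisible = non-leading-not-divisible t m c≢0 m≢lm

  -- Every basis element is x-index i or z-index j: its leading monomial is
  -- not standard, so divisible by some x_i^q or z_j, the leading monomial of
  -- x-index i or z-index j, and interreducedness forces equal indices.
  leading-shape : ∀ t → (∃ λ i → t ≡ x-index i) ⊎ (∃ λ j → t ≡ z-index j)
  leading-shape t with standard-or-divisible (lm t)
  ... | inj₁ std = ⊥-elim (leading-not-standard (g t) (g-∈I t) (lm t) (lm-leading t) std)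
  ... | inj₂ (inj₁ (i , d)) = inj₁ (i , lm-divides-lm t (x-index i) (subst (_∣M lm t) (sym (proj₂ (x-power-basis i))) d))
  ... | inj₂ (inj₂ (j , d)) = inj₂ (j , lm-divides-lm t (z-index j) (subst (_∣M lm t) (sym (proj₂ (z-basis j))) d))

  -- The basis element with leading monomial x_i^q is x_i^q - x_i: their
  -- difference lies in I(C) and has only standard monomials.
  x-basis-element : ∀ i → g (x-index i) ≈ fieldEquation i
  x-basis-element i m = x-y≡0⇒x≡y _ _
      (trans (sym (coeff--P (g t) (fieldEquation i) m)) (standard-vanishes d (∈I--P {g t} {fieldEquation i} (g-∈I t) (fieldEquation-∈I i)) d-standard m))
    where
    t = x-index i
    d = g t -P fieldEquation i
    d-standard : ∀ m → coeff d m ≢ 0# → Standard m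
    d-standard m c≢0 with m ≟M varPow (xVar i) q
    ... | yes refl = ⊥-elim (c≢0 (trans (coeff--P (g t) (fieldEquation i) m)
          (trans (cong₂ _-_ (trans (cong (coeff (g t)) (sym (proj₂ (x-power-basis i)))) (lm-monic t)) (fieldEquation-monic i))
                 (x-x≡0 1#))))
    ... | no m≢xᵢ^q with support--P (g t) (fieldEquation i) m c≢0
    ...   | inj₁ c₁≢0 = non-leading-standard t m c₁≢0 (λ m≡lm → m≢xᵢ^q (trans m≡lm (proj₂ (x-power-basis i))))
    ...   | inj₂ c₂≢0 with fieldEquation-support i m c₂≢0
    ...     | inj₁ m≡xᵢ^q = ⊥-elim (m≢xᵢ^q m≡xᵢ^q)
    ...     | inj₂ refl = x-standard i

  -- The basis element with leading monomial z_j is z_j - f_j, where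
  -- f_j = z_j - g involves only the x's (its monomials are non-leading).
  zTerm : Fin r → Polynomial N
  zTerm j = term 1# (varPow (zVar j) 1)

  xPart : Fin r → Polynomial N
  xPart j = zTerm j -P g (z-index j)

  xPart-InX : ∀ j → InX (xPart j)
  xPart-InX j m c≢0 with m ≟M varPow (zVar j) 1
  ... | yes refl = ⊥-elim (c≢0 (trans (coeff--P (zTerm j) (g t) m)
        (trans (cong₂ _-_ (coeff-term-same 1# m) (trans (cong (coeff (g t)) (sym (proj₂ (z-basis j)))) (lm-monic t)))
               (x-x≡0 1#))))
    where t = z-index j
  ... | no m≢zⱼ with support--P (zTerm j) (g (z-index j)) m c≢0
  ...   | inj₁ c₁≢0 = ⊥-elim (c₁≢0 (coeff-term-other 1# _ m (λ e → m≢zⱼ (sym e))))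
  ...   | inj₂ c₂≢0 = proj₁ (non-leading-standard (z-index j) m c₂≢0 (λ m≡lm → m≢zⱼ (trans m≡lm (proj₂ (z-basis j)))))

  z-basis-element : ∀ j → g (z-index j) ≈ (zTerm j -P xPart j)
  z-basis-element j m = sym (trans (coeff--P (zTerm j) (xPart j) m)
    (trans (cong (λ c → coeff (zTerm j) m - c) (coeff--P (zTerm j) (g (z-index j)) m)) (x-[x-y]≡y _ _)))

  Equations : List (Polynomial N)
  Equations = Eq q ++ Zs xPart

  ∈-map-allFin : ∀ {A : Set} {P : A → Set} {n} (f : Fin n → A) i → P (f i) → Any P (List.map f (List.allFin n))
  ∈-map-allFin f i Pfi = AnyP.map⁺ (Any.map (λ { refl → Pfi }) (∈-allFin i))

  basis-element-in-equations : ∀ t → Any (g t ≈_) Equations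
  basis-element-in-equations t with leading-shape t
  ... | inj₁ (i , t≡xᵢ) = AnyP.++⁺ˡ (∈-map-allFin _ i (subst (λ s → g s ≈ fieldEquation i) (sym t≡xᵢ) (x-basis-element i)))
  ... | inj₂ (j , t≡zⱼ) = AnyP.++⁺ʳ (Eq q) (∈-map-allFin _ j (subst (λ s → g s ≈ (zTerm j -P xPart j)) (sym t≡zⱼ) (z-basis-element j)))

  basis⊆equations : ∀ h → Any (h ≈_) G → Any (h ≈_) Equations
  basis⊆equations h h∈G = Any.map (λ gₜ≈e m → trans (h≈gₜ m) (gₜ≈e m)) (basis-element-in-equations (Any.index h∈G))
    where
    h≈gₜ : h ≈ g (Any.index h∈G)
    h≈gₜ = AnyP.lookup-index h∈G

  ∈-lookup-≈ : ∀ {h} t → h ≈ g t → Any (h ≈_) G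
  ∈-lookup-≈ t h≈g = Any.map (λ { refl → h≈g }) (∈-lookup t)

  equations⊆basis : ∀ h → Any (h ≈_) Equations → Any (h ≈_) G
  equations⊆basis h h∈E with AnyP.++⁻ (Eq q) h∈E
  ... | inj₁ h∈Eq with Any.satisfied (AnyP.map⁻ h∈Eq)
  ...   | i , h≈E = ∈-lookup-≈ {h} (x-index i) (λ m → trans (h≈E m) (sym (x-basis-element i m)))
  equations⊆basis h h∈E | inj₂ h∈Zs with Any.satisfied (AnyP.map⁻ h∈Zs)
  ...   | j , h≈Z = ∈-lookup-≈ {h} (z-index j) (λ m → trans (h≈Z m) (sym (z-basis-element j m)))


-- The theorem: with f_j = xPart j, G = E_q[X] ∪ {z_j - f_j}.
mainTheorem4 : (q : ℕ) → IsPrimePower q → (K : Field) → HasCardinality K q →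
    (k r : ℕ) → 1 ≤ k → 1 ≤ r →
    (φ : Vec (Field.F K) k → Vec (Field.F K) (k ℕ.+ r)) → IsSystematicCode K k r φ →
    (G : List (Poly.Polynomial K (k ℕ.+ r))) →
    Poly.IsReducedGroebnerBasis K (Poly.VanishingIdeal K φ) G →
    Σ (Fin r → Poly.Polynomial K (k ℕ.+ r)) (λ f →
    ((j : Fin r) → Poly.Vars.InX K k r (f j)) ×
    Poly._≈Set_ K G (Poly.Vars.Eq K k r q ++ Poly.Vars.Zs K k r f))
mainTheorem4 q _ K card k r _ _ φ (_ , systematic) G reduced-basis =
  xPart , xPart-InX , λ h → basis⊆equations h , equations⊆basis h
  where open ReducedBasisOfCode K q card k r φ systematic G reduced-basis
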